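{- Let $T$ be a tree. For any positive integer $n\geq 4$, $p(P_n\Box T)=\frac{n_o(P_n\Box T)}{2}$.
   Context: All graphs are finite, simple and undirected. $P_n$ is the path on $n$ vertices. A path decomposition of a graph $G$ is a collection of edge-disjoint paths covering all edges of $G$; $p(G)$ denotes the minimum number of paths in a path decomposition of $G$. $n_o(G)$ denotes the number of vertices of odd degree in $G$. The Cartesian product $G\Box H$ has vertex set $V(G)\times V(H)$, with $(u_1,v_1)(u_2,v_2)$ an edge iff either $u_1u_2\in E(G)$ and $v_1=v_2$, or $v_1v_2\in E(H)$ and $u_1=u_2$. -}

module Defs where

open import Data.Bool using (Bool; true; false; T; _∧_; _∨_; if_then_else_)
open import Data.Nat using (ℕ; zero; suc; _+_; _*_; _≤_; _≡ᵇ_)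
open import Data.Nat.DivMod using (_%_)
open import Data.Fin using (Fin; toℕ; remQuot)
open import Data.Fin.Properties using (_≟_)
open import Data.List using (List; []; _∷_; length; allFin; map; _++_)
open import Data.Nat.ListAction using (sum)
open import Data.List.Relation.Unary.All using (All)
open import Data.List.Relation.Unary.Unique.Propositional using (Unique)
open import Data.List.Relation.Unary.Linked using (Linked)
open import Data.List.Relation.Unary.Any using (Any)
open import Data.Product using (_×_; _,_; Σ; ∃; ∃-syntax)
open import Data.Empty using (⊥; ⊥-elim)
open import Data.Bool.Properties using (∨-comm)
open import Relation.Binary.PropositionalEquality using (_≡_; refl; sym)
open import Relation.Nullary using (¬_; yes; no)
open import Relation.Nullary.Decidable using (⌊_⌋)

record Graph (n : ℕ) : Set where
  field
    adj     : Fin n → Fin n → Bool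
    symm    : ∀ u v → adj u v ≡ adj v u
    irrefl  : ∀ u → adj u u ≡ false
open Graph public

Adj : ∀ {n} → Graph n → Fin n → Fin n → Set
Adj G u v = T (adj G u v)

countB : ∀ {A : Set} → (A → Bool) → List A → ℕ
countB p []       = 0
countB p (x ∷ xs) = (if p x then 1 else 0) + countB p xs

degree : ∀ {n} → Graph n → Fin n → ℕ
degree {n} G u = countB (adj G u) (allFin n)

odd : ℕ → Bool
odd k = (k % 2) ≡ᵇ 1

n-odd : ∀ {n} → Graph n → ℕ
n-odd {n} G = countB (λ u → odd (degree G u)) (allFin n)

IsPath : ∀ {n} → Graph n → List (Fin n) → Set
IsPath G vs = 2 ≤ length vs × Unique vs × Linked (Adj G) vs

steps : ∀ {A : Set} → List A → List (A × A)
steps []           = []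
steps (x ∷ [])     = []
steps (x ∷ y ∷ xs) = (x , y) ∷ steps (y ∷ xs)

sameEdge : ∀ {n} → Fin n → Fin n → Fin n × Fin n → Bool
sameEdge u v (a , b) = (⌊ a ≟ u ⌋ ∧ ⌊ b ≟ v ⌋) ∨ (⌊ a ≟ v ⌋ ∧ ⌊ b ≟ u ⌋)

uses : ∀ {n} → Fin n → Fin n → List (List (Fin n)) → ℕ
uses u v ps = sum (map (λ p → countB (sameEdge u v) (steps p)) ps)

-- A path decomposition: a list of paths of G using every edge of G exactly once
-- (paths only use edges of G, so the paths are edge-disjoint and cover E(G)).
IsPathDecomposition : ∀ {n} → Graph n → List (List (Fin n)) → Set
IsPathDecomposition G ps =
  All (IsPath G) ps × (∀ u v → Adj G u v → uses u v ps ≡ 1)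

PathNumber : ∀ {n} → Graph n → ℕ → Set
PathNumber G k =
  (Σ (List (List _)) λ ps → IsPathDecomposition G ps × length ps ≡ k)
  × (∀ ps → IsPathDecomposition G ps → k ≤ length ps)

data Reach {n} (G : Graph n) (u : Fin n) : Fin n → Set where
  here : Reach G u u
  step : ∀ {v w} → Reach G u v → Adj G v w → Reach G u w

Connected : ∀ {n} → Graph n → Set
Connected G = ∀ u v → Reach G u v

IsCycle : ∀ {n} → Graph n → List (Fin n) → Set
IsCycle G []       = ⊥
IsCycle G (x ∷ xs) = 3 ≤ length (x ∷ xs) × Unique (x ∷ xs) × Linked (Adj G) ((x ∷ xs) ++ (x ∷ []))

Acyclic : ∀ {n} → Graph n → Set
Acyclic G = ∀ vs → ¬ IsCycle G vs

IsTree : ∀ {n} → Graph n → Set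
IsTree {n} G = 1 ≤ n × Connected G × Acyclic G

≡ᵇ-false : ∀ k → (suc k ≡ᵇ k) ≡ false
≡ᵇ-false zero = refl
≡ᵇ-false (suc k) = ≡ᵇ-false k

PathGraph : (n : ℕ) → Graph n
PathGraph n = record { adj = a ; symm = sy ; irrefl = ir }
  where
  a : Fin n → Fin n → Bool
  a i j = (suc (toℕ i) ≡ᵇ toℕ j) ∨ (suc (toℕ j) ≡ᵇ toℕ i)
  sy : ∀ u v → a u v ≡ a v u
  sy u v = ∨-comm (suc (toℕ u) ≡ᵇ toℕ v) _
  ir : ∀ u → a u u ≡ false
  ir u rewrite ≡ᵇ-false (toℕ u) = refl

-- Cartesian product G □ H; vertex (i , j) is encoded as combine i j : Fin (m * k)
eqB : ∀ {n} → Fin n → Fin n → Bool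
eqB a b = ⌊ a ≟ b ⌋

prodAdj : ∀ {m k} → Graph m → Graph k → Fin m × Fin k → Fin m × Fin k → Bool
prodAdj G H (i₁ , j₁) (i₂ , j₂) = (adj G i₁ i₂ ∧ eqB j₁ j₂) ∨ (eqB i₁ i₂ ∧ adj H j₁ j₂)

eqB-sym : ∀ {n} (p q : Fin n) → eqB p q ≡ eqB q p
eqB-sym p q with p ≟ q | q ≟ p
... | yes _ | yes _ = refl
... | no _  | no _  = refl
... | yes e | no ne = ⊥-elim (ne (sym e))
... | no ne | yes e = ⊥-elim (ne (sym e))

eqB-refl : ∀ {n} (p : Fin n) → eqB p p ≡ true
eqB-refl p with p ≟ p
... | yes _ = refl
... | no ne = ⊥-elim (ne refl)

prodAdj-sym : ∀ {m k} (G : Graph m) (H : Graph k) x y → prodAdj G H x y ≡ prodAdj G H y x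
prodAdj-sym G H (i₁ , j₁) (i₂ , j₂)
  rewrite symm G i₁ i₂ | symm H j₁ j₂ | eqB-sym i₁ i₂ | eqB-sym j₁ j₂ = refl

prodAdj-irr : ∀ {m k} (G : Graph m) (H : Graph k) x → prodAdj G H x x ≡ false
prodAdj-irr G H (i , j) rewrite irrefl G i | irrefl H j | eqB-refl i = refl

_□_ : ∀ {m k} → Graph m → Graph k → Graph (m * k)
_□_ {m} {k} G H = record
  { adj    = λ x y → prodAdj G H (remQuot k x) (remQuot k y)
  ; symm   = λ x y → prodAdj-sym G H (remQuot k x) (remQuot k y)
  ; irrefl = λ x → prodAdj-irr G H (remQuot k x)
  }

{-# OPTIONS --safe #-}
-- In a path decomposition, degree x + (number of path ends at x) is even for every vertex x, so each
-- vertex of odd degree ends some path; as every path has two ends, p(G) ≥ n_o(G)/2, with equality for a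
-- decomposition in which no vertex ends more than one path.
-- For G = P_n □ T such a decomposition is built by adding the leaves of T one at a time. For every
-- column v of the current subtree the invariant prescribes which copies of v end a path: the interior
-- ones or the two end ones. The copies of a new leaf ℓ attached to p are covered by extending the paths
-- that end in column p into column ℓ, by new rungs (i,p)(i,ℓ), and by one detour through column ℓ;
-- the two cases of the invariant at p need different constructions, and the second one needs n ≥ 4.
module Submission where

open import Defs
open import Data.Bool using (Bool; true; false; T; _∧_; _∨_; _xor_; not; if_then_else_)
import Data.Bool.Properties as Bool
open import Data.Empty using (⊥-elim)
open import Data.Fin using (Fin; toℕ; combine; remQuot)
import Data.Fin as Fin
import Data.Fin.Properties as Finₚ
open import Data.List using (List; []; _∷_; length; allFin; map; _++_; _ʳ++_; tabulate)
open import Data.List.Properties using (length-++; length-ʳ++; length-tabulate)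
open import Data.List.Membership.Propositional using (_∈_; _∉_)
import Data.List.Membership.Propositional.Properties as Mem
open import Data.List.Relation.Unary.All as All using (All; []; _∷_)
import Data.List.Relation.Unary.All.Properties as AllP
open import Data.List.Relation.Unary.AllPairs using ([]; _∷_)
open import Data.List.Relation.Unary.Any using (here; there)
open import Data.List.Relation.Unary.Linked as Linked using (Linked; []; [-]; _∷_)
open import Data.List.Relation.Unary.Unique.Propositional using (Unique)
import Data.List.Relation.Unary.Unique.Propositional.Properties as Unique
open import Data.Nat using (ℕ; zero; suc; _+_; _*_; _∸_; z≤n; s≤s; _<_; _≤_; _≡ᵇ_; _/_)
open import Data.Nat.DivMod using (_%_; m*n%n≡0; [m+kn]%n≡m%n; m*n/n≡m)
open import Data.Nat.ListAction using (sum)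
open import Data.Nat.Properties
open import Data.Nat.Tactic.RingSolver using (solve-∀)
open import Data.Product using (_×_; _,_; Σ; proj₁; proj₂)
open import Data.Sum as Sum using (_⊎_; inj₁; inj₂; [_,_]′)
open import Function using (_∘_)
open import Relation.Binary.PropositionalEquality
open import Relation.Nullary using (¬_; yes; no)

private variable
  A B : Set
  N : ℕ

χ : Bool → ℕ
χ true  = 1
χ false = 0

∑ : List A → (A → ℕ) → ℕ
∑ []       f = 0
∑ (x ∷ xs) f = f x + ∑ xs f

countB≡∑χ : (p : A → Bool) (xs : List A) → countB p xs ≡ ∑ xs (χ ∘ p)
countB≡∑χ p [] = refl
countB≡∑χ p (x ∷ xs) with p x
... | true  = cong suc (countB≡∑χ p xs)
... | false = countB≡∑χ p xs

sum-map≡∑ : (f : A → ℕ) (xs : List A) → sum (map f xs) ≡ ∑ xs f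
sum-map≡∑ f [] = refl
sum-map≡∑ f (x ∷ xs) = cong (f x +_) (sum-map≡∑ f xs)

∑-cong : ∀ xs {f g : A → ℕ} → (∀ x → f x ≡ g x) → ∑ xs f ≡ ∑ xs g
∑-cong [] e = refl
∑-cong (x ∷ xs) e = cong₂ _+_ (e x) (∑-cong xs e)

∑-congAll : ∀ {xs} {f g : A → ℕ} → All (λ x → f x ≡ g x) xs → ∑ xs f ≡ ∑ xs g
∑-congAll [] = refl
∑-congAll (e ∷ es) = cong₂ _+_ e (∑-congAll es)

∑-zero : (xs : List A) → ∑ xs (λ _ → 0) ≡ 0
∑-zero [] = refl
∑-zero (x ∷ xs) = ∑-zero xs

∑-distrib-+ : ∀ xs (f g : A → ℕ) → ∑ xs (λ x → f x + g x) ≡ ∑ xs f + ∑ xs g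
∑-distrib-+ [] f g = refl
∑-distrib-+ (x ∷ xs) f g rewrite ∑-distrib-+ xs f g =
  +-assoc-middle (f x) (g x) (∑ xs f) (∑ xs g)
  where
  +-assoc-middle : ∀ a b c d → a + b + (c + d) ≡ a + c + (b + d)
  +-assoc-middle = solve-∀

∑-comm : ∀ xs ys (f : A → B → ℕ) → ∑ xs (λ x → ∑ ys (f x)) ≡ ∑ ys (λ y → ∑ xs (λ x → f x y))
∑-comm [] ys f = sym (∑-zero ys)
∑-comm (x ∷ xs) ys f rewrite ∑-comm xs ys f = sym (∑-distrib-+ ys (f x) (λ y → ∑ xs (λ x → f x y)))

∑-++ : ∀ xs ys (f : A → ℕ) → ∑ (xs ++ ys) f ≡ ∑ xs f + ∑ ys f
∑-++ [] ys f = refl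
∑-++ (x ∷ xs) ys f rewrite ∑-++ xs ys f = sym (+-assoc (f x) _ _)

∑-double : ∀ xs (f : A → ℕ) → ∑ xs (λ x → 2 * f x) ≡ 2 * ∑ xs f
∑-double [] f = refl
∑-double (x ∷ xs) f rewrite ∑-double xs f = sym (*-distribˡ-+ 2 (f x) _)

∑-mono-≤ : ∀ xs {f g : A → ℕ} → (∀ x → f x ≤ g x) → ∑ xs f ≤ ∑ xs g
∑-mono-≤ [] e = z≤n
∑-mono-≤ (x ∷ xs) e = +-mono-≤ (e x) (∑-mono-≤ xs e)

∑-tabulate : ∀ {M} (f : Fin N → Fin M) (g : Fin M → ℕ) → ∑ (tabulate f) g ≡ ∑ (allFin N) (g ∘ f)
∑-tabulate {zero} f g = refl
∑-tabulate {suc N} f g = cong (g (f Fin.zero) +_)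
  (trans (∑-tabulate (f ∘ Fin.suc) g) (sym (∑-tabulate Fin.suc (g ∘ f))))

eqB-≢ : {a b : Fin N} → ¬ a ≡ b → eqB a b ≡ false
eqB-≢ {a = a} {b} a≢b with a Finₚ.≟ b
... | yes a≡b = ⊥-elim (a≢b a≡b)
... | no _    = refl

eqB⇒≡ : {a b : Fin N} → eqB a b ≡ true → a ≡ b
eqB⇒≡ {a = a} {b} e with a Finₚ.≟ b
... | yes a≡b = a≡b

eqB-suc : (a b : Fin N) → eqB (Fin.suc a) (Fin.suc b) ≡ eqB a b
eqB-suc a b with a Finₚ.≟ b
... | yes _ = refl
... | no _  = refl

∑-χ-eqB : ∀ N (a : Fin N) → ∑ (allFin N) (λ y → χ (eqB a y)) ≡ 1
∑-χ-eqB (suc N) Fin.zero = cong suc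
  (trans (∑-tabulate {N} Fin.suc (λ y → χ (eqB Fin.zero y))) (∑-zero (allFin N)))
∑-χ-eqB (suc N) (Fin.suc a) =
  trans (∑-tabulate {N} Fin.suc (λ y → χ (eqB (Fin.suc a) y)))
    (trans (∑-cong (allFin N) (λ i → cong χ (eqB-suc a i))) (∑-χ-eqB N a))

∑-χ-eqBʳ : ∀ N (a : Fin N) → ∑ (allFin N) (λ y → χ (eqB y a)) ≡ 1
∑-χ-eqBʳ N a = trans (∑-cong (allFin N) (λ y → cong χ (eqB-sym y a))) (∑-χ-eqB N a)

findFalse : (S : A → Bool) (L : List A) → (Σ A λ v → S v ≡ false) ⊎ (∀ v → v ∈ L → S v ≡ true)
findFalse S [] = inj₂ (λ v ())
findFalse S (x ∷ L) with S x in sx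
... | false = inj₁ (x , sx)
... | true with findFalse S L
...   | inj₁ r = inj₁ r
...   | inj₂ f = inj₂ λ { v (here refl) → sx ; v (there m) → f v m }

∑χ≤length : (S : A → Bool) (L : List A) → ∑ L (χ ∘ S) ≤ length L
∑χ≤length S [] = z≤n
∑χ≤length S (x ∷ L) with S x
... | true  = s≤s (∑χ≤length S L)
... | false = m≤n⇒m≤1+n (∑χ≤length S L)

∑χ≡length : (S : A → Bool) (L : List A) → (∀ v → v ∈ L → S v ≡ true) → ∑ L (χ ∘ S) ≡ length L
∑χ≡length S [] f = refl
∑χ≡length S (x ∷ L) f rewrite f x (here refl) = cong suc (∑χ≡length S L (λ v m → f v (there m)))

∑χ<length : (S : A → Bool) (L : List A) (v : A) → v ∈ L → S v ≡ false → ∑ L (χ ∘ S) < length L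
∑χ<length S (x ∷ L) v (here refl) sv rewrite sv = s≤s (∑χ≤length S L)
∑χ<length S (x ∷ L) v (there m) sv with S x
... | true  = s≤s (∑χ<length S L v m sv)
... | false = m≤n⇒m≤1+n (∑χ<length S L v m sv)

χ≤1 : ∀ b → χ b ≤ 1
χ≤1 true  = ≤-refl
χ≤1 false = z≤n

length-allFin : ∀ n → length (allFin n) ≡ n
length-allFin n = length-tabulate {n = n} (λ i → i)

∑χ-insert : (S : Fin N → Bool) (ℓ : Fin N) (L : List (Fin N)) → S ℓ ≡ false →
  ∑ L (λ v → χ (S v ∨ eqB v ℓ)) ≡ ∑ L (χ ∘ S) + ∑ L (λ v → χ (eqB v ℓ))
∑χ-insert S ℓ L ℓ∉S = trans (∑-cong L pointwise) (∑-distrib-+ L _ _)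
  where
  pointwise : ∀ v → χ (S v ∨ eqB v ℓ) ≡ χ (S v) + χ (eqB v ℓ)
  pointwise v with S v in sv
  ... | false = refl
  ... | true with eqB v ℓ in e
  ...   | false = refl
  ...   | true with () ← trans (sym sv) (trans (cong S (eqB⇒≡ e)) ℓ∉S)

-- Ends of paths and the parity of degrees

lastOf : A → List A → A
lastOf a []      = a
lastOf a (b ∷ l) = lastOf b l

isFirst isLast : Fin N → List (Fin N) → Bool
isFirst z []      = false
isFirst z (a ∷ _) = eqB a z
isLast z []      = false
isLast z (a ∷ l) = eqB (lastOf a l) z

ends : Fin N → List (Fin N) → ℕ
ends z P = χ (isFirst z P) + χ (isLast z P)

endCount : Fin N → List (List (Fin N)) → ℕ
endCount z ps = ∑ ps (ends z)

occurrences : Fin N → List (Fin N) → ℕ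
occurrences z P = ∑ P (λ a → χ (eqB a z))

incidences : Fin N → List (Fin N) → ℕ
incidences x P = ∑ (steps P) (λ s → χ (eqB (proj₁ s) x) + χ (eqB (proj₂ s) x))

traversals : Fin N → Fin N → List (Fin N) → ℕ
traversals u v P = ∑ (steps P) (χ ∘ sameEdge u v)

incidences+ends≡2*occurrences : (x : Fin N) (P : List (Fin N)) →
  incidences x P + ends x P ≡ 2 * occurrences x P
incidences+ends≡2*occurrences x [] = refl
incidences+ends≡2*occurrences x (a ∷ []) = lemma (χ (eqB a x))
  where
  lemma : ∀ a → 0 + (a + a) ≡ 2 * (a + 0)
  lemma = solve-∀
incidences+ends≡2*occurrences x (a ∷ b ∷ l) = begin
  (α + β + incidences x (b ∷ l)) + (α + λ′)  ≡⟨ lemma α β (incidences x (b ∷ l)) λ′ ⟩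
  2 * α + (incidences x (b ∷ l) + (β + λ′))  ≡⟨ cong (2 * α +_) (incidences+ends≡2*occurrences x (b ∷ l)) ⟩
  2 * α + 2 * occurrences x (b ∷ l)          ≡⟨ *-distribˡ-+ 2 α _ ⟨
  2 * occurrences x (a ∷ b ∷ l)              ∎
  where
  open ≡-Reasoning
  α = χ (eqB a x)
  β = χ (eqB b x)
  λ′ = χ (isLast x (b ∷ l))
  lemma : ∀ a b d l → (a + b + d) + (a + l) ≡ 2 * a + (d + (b + l))
  lemma = solve-∀

∨≡true : ∀ a b → a ∨ b ≡ true → a ≡ true ⊎ b ≡ true
∨≡true true  b e = inj₁ refl
∨≡true false b e = inj₂ e

∧≡true : ∀ a b → a ∧ b ≡ true → a ≡ true × b ≡ true
∧≡true true true e = refl , refl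

T⇒≡true : ∀ {b} → T b → b ≡ true
T⇒≡true {true} _ = refl

≡true⇒T : ∀ {b} → b ≡ true → T b
≡true⇒T refl = _

sameEdge⇒ : (x y a b : Fin N) → sameEdge x y (a , b) ≡ true → (a ≡ x × b ≡ y) ⊎ (a ≡ y × b ≡ x)
sameEdge⇒ x y a b e with ∨≡true _ _ e
... | inj₁ e₁ = let p , q = ∧≡true _ _ e₁ in inj₁ (eqB⇒≡ p , eqB⇒≡ q)
... | inj₂ e₂ = let p , q = ∧≡true _ _ e₂ in inj₂ (eqB⇒≡ p , eqB⇒≡ q)

sameEdge-swap : (u v a b : Fin N) → sameEdge u v (a , b) ≡ sameEdge u v (b , a)
sameEdge-swap u v a b = trans (Bool.∨-comm (eqB a u ∧ eqB b v) _)
  (cong₂ _∨_ (Bool.∧-comm (eqB a v) _) (Bool.∧-comm (eqB a u) _))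

sameEdge-sym : (x y : Fin N) (s : Fin N × Fin N) → sameEdge x y s ≡ sameEdge y x s
sameEdge-sym x y (a , b) = Bool.∨-comm (eqB a x ∧ eqB b y) _

∑-sameEdge : ∀ (x a b : Fin N) → ¬ a ≡ b →
  ∑ (allFin N) (λ y → χ (sameEdge x y (a , b))) ≡ χ (eqB a x) + χ (eqB b x)
∑-sameEdge {N} x a b a≢b = go (eqB a x) (eqB b x) refl refl
  where
  go : ∀ r s → eqB a x ≡ r → eqB b x ≡ s →
    ∑ (allFin N) (λ y → χ (sameEdge x y (a , b))) ≡ χ (eqB a x) + χ (eqB b x)
  go true true ea eb = ⊥-elim (a≢b (trans (eqB⇒≡ ea) (sym (eqB⇒≡ eb))))
  go true false ea eb rewrite ea | eb = trans
    (∑-cong (allFin N) (λ y → cong χ (trans (cong (eqB b y ∨_) (Bool.∧-zeroʳ (eqB a y))) (Bool.∨-identityʳ (eqB b y)))))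
    (∑-χ-eqB N b)
  go false true ea eb rewrite ea | eb =
    trans (∑-cong (allFin N) (λ y → cong χ (Bool.∧-identityʳ (eqB a y)))) (∑-χ-eqB N a)
  go false false ea eb rewrite ea | eb =
    trans (∑-cong (allFin N) (λ y → cong χ (Bool.∧-zeroʳ (eqB a y)))) (∑-zero (allFin N))

adj⇒≢ : (G : Graph N) {a b : Fin N} → Adj G a b → ¬ a ≡ b
adj⇒≢ G {a} e refl rewrite irrefl G a = e

Linked⇒All-steps : ∀ {R : A → A → Set} {P} → Linked R P → All (λ s → R (proj₁ s) (proj₂ s)) (steps P)
Linked⇒All-steps []      = []
Linked⇒All-steps [-]     = []
Linked⇒All-steps (r ∷ l) = r ∷ Linked⇒All-steps l

∑-traversals≡incidences : (G : Graph N) (x : Fin N) (P : List (Fin N)) → Linked (Adj G) P →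
  ∑ (allFin N) (λ y → traversals x y P) ≡ incidences x P
∑-traversals≡incidences {N} G x P l =
  trans (∑-comm (allFin N) (steps P) (λ y s → χ (sameEdge x y s))) (∑-congAll (go (Linked⇒All-steps l)))
  where
  go : ∀ {ss} → All (λ s → Adj G (proj₁ s) (proj₂ s)) ss →
    All (λ s → ∑ (allFin N) (λ y → χ (sameEdge x y s)) ≡ χ (eqB (proj₁ s) x) + χ (eqB (proj₂ s) x)) ss
  go [] = []
  go {(a , b) ∷ _} (e ∷ es) = ∑-sameEdge x a b (adj⇒≢ G e) ∷ go es

uses≡∑traversals : (x y : Fin N) (ps : List (List (Fin N))) → uses x y ps ≡ ∑ ps (traversals x y)
uses≡∑traversals x y ps = trans (sum-map≡∑ _ ps) (∑-cong ps (λ P → countB≡∑χ (sameEdge x y) (steps P)))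

traversals-sym : (x y : Fin N) (P : List (Fin N)) → traversals x y P ≡ traversals y x P
traversals-sym x y P = ∑-cong (steps P) (cong χ ∘ sameEdge-sym x y)

sameEdge⇒adj : (G : Graph N) (x y a b : Fin N) → Adj G a b → sameEdge x y (a , b) ≡ true → adj G x y ≡ true
sameEdge⇒adj G x y a b e s with sameEdge⇒ x y a b s
... | inj₁ (refl , refl) = T⇒≡true e
... | inj₂ (refl , refl) = trans (symm G x y) (T⇒≡true e)

traversals-nonedge : (G : Graph N) (x y : Fin N) (P : List (Fin N)) → Linked (Adj G) P →
  adj G x y ≡ false → traversals x y P ≡ 0
traversals-nonedge G x y P l x≁y = trans (∑-congAll (go (Linked⇒All-steps l))) (∑-zero (steps P))
  where
  go : ∀ {ss} → All (λ s → Adj G (proj₁ s) (proj₂ s)) ss → All (λ s → χ (sameEdge x y s) ≡ 0) ss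
  go [] = []
  go {(a , b) ∷ _} (e ∷ es) with sameEdge x y (a , b) in se
  ... | false = cong χ se ∷ go es
  ... | true with () ← trans (sym x≁y) (sameEdge⇒adj G x y a b e se)

uses-nonedge : (G : Graph N) (x y : Fin N) (ps : List (List (Fin N))) → All (IsPath G) ps →
  adj G x y ≡ false → uses x y ps ≡ 0
uses-nonedge G x y ps ips x≁y = trans (uses≡∑traversals x y ps) (go ips)
  where
  go : ∀ {qs} → All (IsPath G) qs → ∑ qs (traversals x y) ≡ 0
  go [] = refl
  go {P ∷ _} ((_ , _ , l) ∷ ips) = cong₂ _+_ (traversals-nonedge G x y P l x≁y) (go ips)

degree≡∑uses : (G : Graph N) (x : Fin N) (ps : List (List (Fin N))) → IsPathDecomposition G ps →
  degree G x ≡ ∑ (allFin N) (λ y → uses x y ps)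
degree≡∑uses {N} G x ps (ips , once) = trans (countB≡∑χ (adj G x) (allFin N)) (∑-cong (allFin N) pointwise)
  where
  pointwise : ∀ y → χ (adj G x y) ≡ uses x y ps
  pointwise y with adj G x y in e
  ... | true  = sym (once x y (≡true⇒T e))
  ... | false = sym (uses-nonedge G x y ps ips e)

degree+endCount≡2*occurrences : (G : Graph N) (x : Fin N) (ps : List (List (Fin N))) →
  IsPathDecomposition G ps → degree G x + endCount x ps ≡ 2 * ∑ ps (occurrences x)
degree+endCount≡2*occurrences {N} G x ps d@(ips , _) = begin
  degree G x + endCount x ps
    ≡⟨ cong (_+ endCount x ps) (degree≡∑uses G x ps d) ⟩
  ∑ (allFin N) (λ y → uses x y ps) + endCount x ps
    ≡⟨ cong (_+ endCount x ps) (trans (∑-cong (allFin N) (λ y → uses≡∑traversals x y ps))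
                                       (∑-comm (allFin N) ps (λ y → traversals x y))) ⟩
  ∑ ps (λ P → ∑ (allFin N) (λ y → traversals x y P)) + endCount x ps
    ≡⟨ cong (_+ endCount x ps) (∑-congAll (All.map (λ (_ , _ , l) → ∑-traversals≡incidences G x _ l) ips)) ⟩
  ∑ ps (incidences x) + endCount x ps
    ≡⟨ ∑-distrib-+ ps (incidences x) (ends x) ⟨
  ∑ ps (λ P → incidences x P + ends x P)
    ≡⟨ ∑-cong ps (incidences+ends≡2*occurrences x) ⟩
  ∑ ps (λ P → 2 * occurrences x P)
    ≡⟨ ∑-double ps (occurrences x) ⟩
  2 * ∑ ps (occurrences x) ∎
  where open ≡-Reasoning

∑-ends≡2 : ∀ (a : Fin N) l → ∑ (allFin N) (λ x → ends x (a ∷ l)) ≡ 2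
∑-ends≡2 {N} a l = trans (∑-distrib-+ (allFin N) (λ x → χ (eqB a x)) (λ x → χ (eqB (lastOf a l) x)))
  (cong₂ _+_ (∑-χ-eqB N a) (∑-χ-eqB N (lastOf a l)))

∑-endCount≡2*length : (G : Graph N) (ps : List (List (Fin N))) → All (IsPath G) ps →
  ∑ (allFin N) (λ x → endCount x ps) ≡ 2 * length ps
∑-endCount≡2*length {N} G ps ips = trans (∑-comm (allFin N) ps ends) (go ips)
  where
  go : ∀ {qs} → All (IsPath G) qs → ∑ qs (λ P → ∑ (allFin N) (λ x → ends x P)) ≡ 2 * length qs
  go [] = refl
  go {[] ∷ _} ((() , _) ∷ _)
  go {(a ∷ l) ∷ qs} (_ ∷ ips) = trans (cong₂ _+_ (∑-ends≡2 a l) (go ips)) (sym (*-distribˡ-+ 2 1 (length qs)))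

odd-2* : ∀ k → odd (2 * k) ≡ false
odd-2* k = cong (_≡ᵇ 1) (trans (cong (_% 2) (*-comm 2 k)) (m*n%n≡0 k 2))

odd-1+2* : ∀ k → odd (1 + 2 * k) ≡ true
odd-1+2* k = cong (_≡ᵇ 1) (trans (cong (λ t → (1 + t) % 2) (*-comm 2 k)) ([m+kn]%n≡m%n 1 k 2))

χ-odd≤ : ∀ d e k → d + e ≡ 2 * k → χ (odd d) ≤ e
χ-odd≤ d zero k eq rewrite trans (sym (+-identityʳ d)) eq | odd-2* k = z≤n
χ-odd≤ d (suc e) k eq with odd d
... | true  = s≤s z≤n
... | false = z≤n

χ-odd≡ : ∀ d e k → d + e ≡ 2 * k → e ≤ 1 → χ (odd d) ≡ e
χ-odd≡ d zero k eq _ rewrite trans (sym (+-identityʳ d)) eq | odd-2* k = refl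
χ-odd≡ d (suc zero) zero eq _ with () ← trans (sym (+-comm d 1)) eq
χ-odd≡ d (suc zero) (suc k) eq _ = subst (λ t → χ (odd t) ≡ 1) (sym d≡1+2k) (cong χ (odd-1+2* k))
  where
  lemma : ∀ k → 2 * suc k ≡ 1 + 2 * k + 1
  lemma = solve-∀
  d≡1+2k : d ≡ 1 + 2 * k
  d≡1+2k = +-cancelʳ-≡ 1 d (1 + 2 * k) (trans eq (lemma k))
χ-odd≡ d (suc (suc e)) k eq (s≤s ())

n-odd≡∑ : (G : Graph N) → n-odd G ≡ ∑ (allFin N) (λ x → χ (odd (degree G x)))
n-odd≡∑ {N} G = countB≡∑χ (λ u → odd (degree G u)) (allFin N)

n-odd≤2*length : (G : Graph N) (ps : List (List (Fin N))) → IsPathDecomposition G ps → n-odd G ≤ 2 * length ps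
n-odd≤2*length {N} G ps d@(ips , _) = subst₂ _≤_ (sym (n-odd≡∑ G)) (∑-endCount≡2*length G ps ips)
  (∑-mono-≤ (allFin N) (λ x → χ-odd≤ _ _ (∑ ps (occurrences x)) (degree+endCount≡2*occurrences G x ps d)))

n-odd≡2*length : (G : Graph N) (ps : List (List (Fin N))) → IsPathDecomposition G ps →
  (∀ x → endCount x ps ≤ 1) → n-odd G ≡ 2 * length ps
n-odd≡2*length {N} G ps d@(ips , _) ends≤1 = trans (n-odd≡∑ G) (trans
  (∑-cong (allFin N) (λ x → χ-odd≡ _ _ (∑ ps (occurrences x)) (degree+endCount≡2*occurrences G x ps d) (ends≤1 x)))
  (∑-endCount≡2*length G ps ips))

pathNumber-from-decomposition : (G : Graph N) (ps : List (List (Fin N))) → IsPathDecomposition G ps →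
  (∀ x → endCount x ps ≤ 1) → PathNumber G (n-odd G / 2)
pathNumber-from-decomposition G ps d ends≤1 rewrite n-odd≡2*length G ps d ends≤1 =
  (ps , d , sym half) ,
  λ qs dq → subst (_≤ length qs) (sym half)
    (*-cancelˡ-≤ 2 (subst (_≤ 2 * length qs) (n-odd≡2*length G ps d ends≤1) (n-odd≤2*length G qs dq)))
  where
  half : 2 * length ps / 2 ≡ length ps
  half = trans (cong (_/ 2) (*-comm 2 (length ps))) (m*n/n≡m (length ps) 2)

-- Extending a path decomposition at an end

attach : Fin N → List (Fin N) → List (List (Fin N)) → List (List (Fin N))
attach x r [] = (x ∷ r) ∷ []
attach x r (P ∷ ps) with isLast x P
... | true = (P ++ r) ∷ ps
... | false with isFirst x P
...   | true  = (r ʳ++ P) ∷ ps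
...   | false = P ∷ attach x r ps

Fresh : Fin N → List (List (Fin N)) → Set
Fresh z ps = All (z ∉_) ps

steps-++ : (a : A) (l r : List A) → steps ((a ∷ l) ++ r) ≡ steps (a ∷ l) ++ steps (lastOf a l ∷ r)
steps-++ a [] r = refl
steps-++ a (b ∷ l) r = cong ((a , b) ∷_) (steps-++ b l r)

traversals-++ : (u v a : Fin N) (l r : List (Fin N)) →
  traversals u v ((a ∷ l) ++ r) ≡ traversals u v (a ∷ l) + traversals u v (lastOf a l ∷ r)
traversals-++ u v a l r rewrite steps-++ a l r = ∑-++ (steps (a ∷ l)) _ _

traversals-ʳ++ : (u v : Fin N) (r : List (Fin N)) (y : Fin N) (Q : List (Fin N)) →
  traversals u v (r ʳ++ (y ∷ Q)) ≡ traversals u v (y ∷ Q) + traversals u v (y ∷ r)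
traversals-ʳ++ u v [] y Q = sym (+-identityʳ _)
traversals-ʳ++ u v (a ∷ r) y Q rewrite traversals-ʳ++ u v r a (y ∷ Q) | sameEdge-swap u v a y =
  lemma (χ (sameEdge u v (y , a))) (traversals u v (y ∷ Q)) (traversals u v (a ∷ r))
  where
  lemma : ∀ a b c → a + b + c ≡ b + (a + c)
  lemma = solve-∀

∑traversals-attach : (u v x : Fin N) (r : List (Fin N)) (ps : List (List (Fin N))) →
  ∑ (attach x r ps) (traversals u v) ≡ ∑ ps (traversals u v) + traversals u v (x ∷ r)
∑traversals-attach u v x r [] = +-comm (traversals u v (x ∷ r)) 0
∑traversals-attach u v x r ([] ∷ ps) = ∑traversals-attach u v x r ps
∑traversals-attach u v x r ((a ∷ l) ∷ ps) with isLast x (a ∷ l) in last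
... | true rewrite traversals-++ u v a l r | eqB⇒≡ last =
  lemma (traversals u v (a ∷ l)) (traversals u v (x ∷ r)) (∑ ps (traversals u v))
  where
  lemma : ∀ a b c → a + b + c ≡ a + c + b
  lemma = solve-∀
... | false with isFirst x (a ∷ l) in first
...   | true rewrite eqB⇒≡ first | traversals-ʳ++ u v r x l =
  lemma (traversals u v (x ∷ l)) (traversals u v (x ∷ r)) (∑ ps (traversals u v))
  where
  lemma : ∀ a b c → a + b + c ≡ a + c + b
  lemma = solve-∀
...   | false rewrite ∑traversals-attach u v x r ps = sym (+-assoc (traversals u v (a ∷ l)) _ _)

lastOf-++ : (a : A) (l r : List A) → lastOf a (l ++ r) ≡ lastOf (lastOf a l) r
lastOf-++ a [] r = refl
lastOf-++ a (b ∷ l) r = lastOf-++ b l r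

ends-ʳ++ : (z : Fin N) (r : List (Fin N)) (y : Fin N) (Q : List (Fin N)) →
  ends z (r ʳ++ (y ∷ Q)) ≡ χ (eqB (lastOf y r) z) + χ (eqB (lastOf y Q) z)
ends-ʳ++ z [] y Q = refl
ends-ʳ++ z (a ∷ r) y Q = ends-ʳ++ z r a (y ∷ Q)

ends-++ : (z a : Fin N) (l r : List (Fin N)) →
  ends z ((a ∷ l) ++ r) ≡ χ (eqB a z) + χ (eqB (lastOf (lastOf a l) r) z)
ends-++ z a l r = cong (λ t → χ (eqB a z) + χ (eqB t z)) (lastOf-++ a l r)

χ-eqB-≢ : {a b : Fin N} → ¬ a ≡ b → χ (eqB a b) ≡ 0
χ-eqB-≢ a≢b = cong χ (eqB-≢ a≢b)

χ-eqB-refl : (a : Fin N) → χ (eqB a a) ≡ 1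
χ-eqB-refl a = cong χ (eqB-refl a)

endCount-attach-elsewhere : (z x : Fin N) (r : List (Fin N)) (ps : List (List (Fin N))) →
  ¬ z ≡ x → ¬ z ≡ lastOf x r → endCount z (attach x r ps) ≡ endCount z ps
endCount-attach-elsewhere z x r [] z≢x z≢y
  rewrite χ-eqB-≢ {a = x} (z≢x ∘ sym) | χ-eqB-≢ {a = lastOf x r} (z≢y ∘ sym) = refl
endCount-attach-elsewhere z x r ([] ∷ ps) z≢x z≢y = endCount-attach-elsewhere z x r ps z≢x z≢y
endCount-attach-elsewhere z x r ((a ∷ l) ∷ ps) z≢x z≢y with isLast x (a ∷ l) in last
... | true rewrite ends-++ z a l r | eqB⇒≡ last
  | χ-eqB-≢ {a = x} (z≢x ∘ sym) | χ-eqB-≢ {a = lastOf x r} (z≢y ∘ sym) = refl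
... | false with isFirst x (a ∷ l) in first
...   | true rewrite eqB⇒≡ first | ends-ʳ++ z r x l
  | χ-eqB-≢ {a = x} (z≢x ∘ sym) | χ-eqB-≢ {a = lastOf x r} (z≢y ∘ sym) = refl
...   | false rewrite endCount-attach-elsewhere z x r ps z≢x z≢y = refl

endCount-attach-newEnd : (x : Fin N) (r : List (Fin N)) (ps : List (List (Fin N))) → ¬ lastOf x r ≡ x →
  endCount (lastOf x r) (attach x r ps) ≡ endCount (lastOf x r) ps + 1
endCount-attach-newEnd x r [] y≢x rewrite χ-eqB-≢ {a = x} (y≢x ∘ sym) | χ-eqB-refl (lastOf x r) = refl
endCount-attach-newEnd x r ([] ∷ ps) y≢x = endCount-attach-newEnd x r ps y≢x
endCount-attach-newEnd x r ((a ∷ l) ∷ ps) y≢x with isLast x (a ∷ l) in last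
... | true rewrite ends-++ (lastOf x r) a l r | eqB⇒≡ last
  | χ-eqB-≢ {a = x} (y≢x ∘ sym) | χ-eqB-refl (lastOf x r) =
  lemma (χ (eqB a (lastOf x r))) (endCount (lastOf x r) ps)
  where
  lemma : ∀ a e → a + 1 + e ≡ a + 0 + e + 1
  lemma = solve-∀
... | false with isFirst x (a ∷ l) in first
...   | true rewrite eqB⇒≡ first | ends-ʳ++ (lastOf x r) r x l
  | χ-eqB-≢ {a = x} (y≢x ∘ sym) | χ-eqB-refl (lastOf x r) =
  lemma (χ (eqB (lastOf x l) (lastOf x r))) (endCount (lastOf x r) ps)
  where
  lemma : ∀ a e → 1 + a + e ≡ 0 + a + e + 1
  lemma = solve-∀
...   | false rewrite endCount-attach-newEnd x r ps y≢x = sym (+-assoc (ends (lastOf x r) (a ∷ l)) _ 1)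

+-≤1⇒≡0 : ∀ a e → a + 1 + e ≤ 1 → a ≡ 0 × e ≡ 0
+-≤1⇒≡0 zero zero _ = refl , refl
+-≤1⇒≡0 zero (suc e) (s≤s ())
+-≤1⇒≡0 (suc a) e (s≤s h) with () ← ≤-trans (≤-trans (m≤n+m 1 a) (m≤m+n (a + 1) e)) h

endCount-attach-joined : (x : Fin N) (r : List (Fin N)) (ps : List (List (Fin N))) → ¬ lastOf x r ≡ x →
  endCount x ps ≤ 1 → endCount x (attach x r ps) + endCount x ps ≡ 1
endCount-attach-joined x r [] y≢x _ rewrite χ-eqB-≢ y≢x | χ-eqB-refl x = refl
endCount-attach-joined x r ([] ∷ ps) y≢x ≤1 = endCount-attach-joined x r ps y≢x ≤1
endCount-attach-joined x r ((a ∷ l) ∷ ps) y≢x ≤1 with isLast x (a ∷ l) in last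
... | true rewrite ends-++ x a l r | eqB⇒≡ last | χ-eqB-≢ y≢x
  with +-≤1⇒≡0 (χ (eqB a x)) (endCount x ps) ≤1
...   | e₁ , e₂ rewrite e₁ | e₂ = refl
endCount-attach-joined x r ((a ∷ l) ∷ ps) y≢x ≤1 | false with isFirst x (a ∷ l) in first
...   | true with eqB⇒≡ first
...     | refl rewrite ends-ʳ++ x r x l | χ-eqB-≢ y≢x | last
  with +-≤1⇒≡0 0 (endCount x ps) ≤1
...   | _ , e₂ rewrite e₂ = refl
endCount-attach-joined x r ((a ∷ l) ∷ ps) y≢x ≤1 | false | false with ≤1
... | ≤1′ rewrite first | last = endCount-attach-joined x r ps y≢x ≤1′

Linked-++ : ∀ {R : A → A → Set} (a : A) l r → Linked R (a ∷ l) → Linked R (lastOf a l ∷ r) → Linked R ((a ∷ l) ++ r)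
Linked-++ a [] r _ h = h
Linked-++ a (b ∷ l) r (e ∷ h₁) h₂ = e ∷ Linked-++ b l r h₁ h₂

Linked-ʳ++ : ∀ {R : A → A → Set} → (∀ {u v} → R u v → R v u) →
  ∀ r (y : A) Q → Linked R (y ∷ Q) → Linked R (y ∷ r) → Linked R (r ʳ++ (y ∷ Q))
Linked-ʳ++ sym-R [] y Q h _ = h
Linked-ʳ++ sym-R (a ∷ r) y Q h (e ∷ h₂) = Linked-ʳ++ sym-R r a (y ∷ Q) (sym-R e ∷ h) h₂

∈-ʳ++⁻ : {z : A} (r Q : List A) → z ∈ r ʳ++ Q → z ∈ r ⊎ z ∈ Q
∈-ʳ++⁻ [] Q m = inj₂ m
∈-ʳ++⁻ (a ∷ r) Q m with ∈-ʳ++⁻ r (a ∷ Q) m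
... | inj₁ m′ = inj₁ (there m′)
... | inj₂ (here e) = inj₁ (here e)
... | inj₂ (there m′) = inj₂ m′

Unique-ʳ++ : (r Q : List A) → Unique Q → Unique r → (∀ {z} → z ∈ r → z ∉ Q) → Unique (r ʳ++ Q)
Unique-ʳ++ [] Q uQ _ _ = uQ
Unique-ʳ++ (a ∷ r) Q uQ (a∉r ∷ ur) disjoint =
  Unique-ʳ++ r (a ∷ Q) (All.tabulate (λ zQ e → disjoint (here refl) (subst (_∈ Q) (sym e) zQ)) ∷ uQ) ur
    (λ zr → λ { (here e) → All.lookup a∉r zr (sym e) ; (there zQ) → disjoint (there zr) zQ })

IsPath-attach : (G : Graph N) (x : Fin N) (r : List (Fin N)) (ps : List (List (Fin N))) → All (IsPath G) ps →
  Linked (Adj G) (x ∷ r) → Unique (x ∷ r) → 1 ≤ length r → (∀ {z} → z ∈ r → Fresh z ps) →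
  All (IsPath G) (attach x r ps)
IsPath-attach G x r [] [] linked unique nonempty fresh = (s≤s nonempty , unique , linked) ∷ []
IsPath-attach G x r ([] ∷ ps) (ip ∷ ips) linked unique nonempty fresh =
  ip ∷ IsPath-attach G x r ps ips linked unique nonempty (All.tail ∘ fresh)
IsPath-attach G x r ((a ∷ l) ∷ ps) ((len , uP , lP) ∷ ips) linked (_ ∷ unique) nonempty fresh with isLast x (a ∷ l) in last
... | true = (len′ , Unique.++⁺ uP unique disjoint , Linked-++ a l r lP (subst (λ t → Linked (Adj G) (t ∷ r)) (sym (eqB⇒≡ last)) linked)) ∷ ips
  where
  len′ : 2 ≤ length ((a ∷ l) ++ r)
  len′ rewrite length-++ (a ∷ l) {r} = ≤-trans len (m≤m+n (length (a ∷ l)) (length r))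
  disjoint : ∀ {v} → ¬ (v ∈ (a ∷ l) × v ∈ r)
  disjoint (v∈P , v∈r) = All.head (fresh v∈r) v∈P
... | false with isFirst x (a ∷ l) in first
...   | true with eqB⇒≡ first
...     | refl = (len′ , Unique-ʳ++ r (x ∷ l) uP unique (λ z∈r → All.head (fresh z∈r))
                 , Linked-ʳ++ (λ {u} {v} e → subst T (symm G u v) e) r x l lP linked) ∷ ips
  where
  len′ : 2 ≤ length (r ʳ++ (x ∷ l))
  len′ rewrite length-ʳ++ r {x ∷ l} = ≤-trans len (m≤n+m (length (x ∷ l)) (length r))
IsPath-attach G x r ((a ∷ l) ∷ ps) (ip ∷ ips) linked unique nonempty fresh | false | false =
  ip ∷ IsPath-attach G x r ps ips linked unique nonempty (All.tail ∘ fresh)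

Fresh-attach : (z x : Fin N) (r : List (Fin N)) (ps : List (List (Fin N))) →
  Fresh z ps → z ∉ (x ∷ r) → Fresh z (attach x r ps)
Fresh-attach z x r [] [] z∉ = z∉ ∷ []
Fresh-attach z x r ([] ∷ ps) (f ∷ fs) z∉ = f ∷ Fresh-attach z x r ps fs z∉
Fresh-attach z x r ((a ∷ l) ∷ ps) (f ∷ fs) z∉ with isLast x (a ∷ l)
... | true = [ f , z∉ ∘ there ]′ ∘ Mem.∈-++⁻ (a ∷ l) ∷ fs
... | false with isFirst x (a ∷ l)
...   | true  = [ z∉ ∘ there , f ]′ ∘ ∈-ʳ++⁻ r (a ∷ l) ∷ fs
...   | false = f ∷ Fresh-attach z x r ps fs z∉

-- Walks in a tree

Unique-++⁻ʳ : (xs : List A) {ys : List A} → Unique (xs ++ ys) → Unique ys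
Unique-++⁻ʳ [] u = u
Unique-++⁻ʳ (x ∷ xs) (_ ∷ u) = Unique-++⁻ʳ xs u

Linked-++⁻ʳ : ∀ {R : A → A → Set} (xs : List A) {ys} → Linked R (xs ++ ys) → Linked R ys
Linked-++⁻ʳ [] l = l
Linked-++⁻ʳ (x ∷ []) {[]} l = []
Linked-++⁻ʳ (x ∷ []) {y ∷ ys} (_ ∷ l) = l
Linked-++⁻ʳ (x ∷ x′ ∷ xs) (_ ∷ l) = Linked-++⁻ʳ (x′ ∷ xs) l

lastOf-++-∷ : (xs : List A) (u : A) (B : List A) {h : A} {t : List A} → h ∷ t ≡ xs ++ u ∷ B → lastOf h t ≡ lastOf u B
lastOf-++-∷ [] u B refl = refl
lastOf-++-∷ (x ∷ []) u B refl = refl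
lastOf-++-∷ (x ∷ x′ ∷ xs) u B refl = lastOf-++-∷ (x′ ∷ xs) u B refl

∈-Linked⇒neighbour : ∀ {R : A → A → Set} {L : List A} {z} → Linked R L → 2 ≤ length L → z ∈ L →
  Σ A λ w → R z w ⊎ R w z
∈-Linked⇒neighbour {L = a ∷ []} [-] (s≤s ()) _
∈-Linked⇒neighbour {L = a ∷ b ∷ l} (e ∷ _) _ (here refl) = b , inj₁ e
∈-Linked⇒neighbour {L = a ∷ b ∷ l} (e ∷ _) _ (there (here refl)) = a , inj₂ e
∈-Linked⇒neighbour {L = a ∷ b ∷ c ∷ l} (_ ∷ lk) _ (there (there z∈)) = ∈-Linked⇒neighbour lk (s≤s (s≤s z≤n)) (there z∈)

module Walks {m} (Tr : Graph m) where

  open import Data.List.Membership.DecPropositional (Finₚ._≟_ {m}) using (_∈?_)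

  data Walk (S : Fin m → Bool) : Fin m → Fin m → Set where
    nil  : ∀ {u} → T (S u) → Walk S u u
    cons : ∀ {u w v} → T (S u) → Adj Tr u w → Walk S w v → Walk S u v

  snoc : ∀ {S u v w} → Walk S u v → Adj Tr v w → T (S w) → Walk S u w
  snoc (nil s) e s′ = cons s e (nil s′)
  snoc (cons s e₀ w) e s′ = cons s e₀ (snoc w e s′)

  reverse : ∀ {S u v} → Walk S u v → Walk S v u
  reverse (nil s) = nil s
  reverse {u = u} (cons {w = w} s e wk) = snoc (reverse wk) (subst T (symm Tr u w) e) s

  _++ʷ_ : ∀ {S u w v} → Walk S u w → Walk S w v → Walk S u v
  nil _ ++ʷ w₂ = w₂
  cons s e w₁ ++ʷ w₂ = cons s e (w₁ ++ʷ w₂)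

  weaken : ∀ {S S′ u v} → (∀ x → T (S x) → T (S′ x)) → Walk S u v → Walk S′ u v
  weaken f (nil s) = nil (f _ s)
  weaken f (cons s e w) = cons (f _ s) e (weaken f w)

  SimplePath : (S : Fin m → Bool) → Fin m → Fin m → Set
  SimplePath S u v = Σ (List (Fin m)) λ L →
    Unique (u ∷ L) × Linked (Adj Tr) (u ∷ L) × lastOf u L ≡ v × All (T ∘ S) (u ∷ L)

  simplify : ∀ {S u v} → Walk S u v → SimplePath S u v
  simplify (nil s) = [] , ([] ∷ []) , [-] , refl , (s ∷ [])
  simplify {S} {u} (cons {w = w} s e wk) with simplify wk
  ... | L , uL , lL , eL , aL with u ∈? (w ∷ L)
  ... | yes u∈ = let ys , zs , eq = Mem.∈-∃++ u∈ in
    zs , Unique-++⁻ʳ ys (subst Unique eq uL) , Linked-++⁻ʳ ys (subst (Linked (Adj Tr)) eq lL) ,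
    trans (sym (lastOf-++-∷ ys u zs eq)) eL , AllP.++⁻ʳ ys (subst (All (T ∘ S)) eq aL)
  ... | no u∉ = w ∷ L , (All.tabulate (λ y∈ u≡y → u∉ (subst (_∈ (w ∷ L)) (sym u≡y) y∈)) ∷ uL) , e ∷ lL , eL , s ∷ aL

  acyclic⇒unique-neighbour : ∀ {S : Fin m → Bool} {p q ℓ : Fin m} → Acyclic Tr → S ℓ ≡ false →
    Adj Tr ℓ p → Adj Tr ℓ q → Walk S p q → q ≡ p
  acyclic⇒unique-neighbour {S} {p} {q} {ℓ} acyclic ℓ∉S ℓ~p ℓ~q wk with q Finₚ.≟ p
  ... | yes q≡p = q≡p
  ... | no q≢p with simplify wk
  ...   | [] , _ , _ , eL , _ = ⊥-elim (q≢p (sym eL))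
  ...   | (b ∷ L) , uL , lL , eL , aL = ⊥-elim (acyclic (ℓ ∷ p ∷ b ∷ L) (s≤s (s≤s (s≤s z≤n)) , (ℓ∉ ∷ uL) , cycle))
    where
    ℓ∉ : All (ℓ ≢_) (p ∷ b ∷ L)
    ℓ∉ = All.map (λ sz ℓ≡z → subst T (trans (cong S (sym ℓ≡z)) ℓ∉S) sz) aL
    q~ℓ : Adj Tr (lastOf p (b ∷ L)) ℓ
    q~ℓ = subst (λ t → Adj Tr t ℓ) (sym eL) (subst T (symm Tr ℓ q) ℓ~q)
    cycle : Linked (Adj Tr) ((ℓ ∷ p ∷ b ∷ L) ++ (ℓ ∷ []))
    cycle = ℓ~p ∷ Linked-++ p (b ∷ L) (ℓ ∷ []) lL (q~ℓ ∷ [-])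

  boundary-edge : ∀ {S : Fin m → Bool} {r v : Fin m} → T (S r) → S v ≡ false → Reach Tr r v →
    Σ (Fin m) λ p → Σ (Fin m) λ ℓ → T (S p) × S ℓ ≡ false × Adj Tr p ℓ
  boundary-edge r∈S v∉S here = ⊥-elim (subst T v∉S r∈S)
  boundary-edge {S} r∈S b∉S (step {a} R e) with S a in a∈S
  ... | true  = a , _ , ≡true⇒T a∈S , b∉S , e
  ... | false = boundary-edge r∈S a∈S R

≡ᵇ-refl : ∀ a → (a ≡ᵇ a) ≡ true
≡ᵇ-refl zero    = refl
≡ᵇ-refl (suc a) = ≡ᵇ-refl a

≡ᵇ-≢ : ∀ a b → ¬ a ≡ b → (a ≡ᵇ b) ≡ false
≡ᵇ-≢ a b a≢b with a ≡ᵇ b in e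
... | false = refl
... | true  = ⊥-elim (a≢b (≡ᵇ⇒≡ a b (≡true⇒T e)))

≡ᵇ-true⇒≡ : ∀ a b → (a ≡ᵇ b) ≡ true → a ≡ b
≡ᵇ-true⇒≡ a b e = ≡ᵇ⇒≡ a b (≡true⇒T e)

shift-≤ : ∀ {a len b} → a + suc len ≤ b → suc a + len ≤ b
shift-≤ {a} {len} {b} = subst (_≤ b) (+-suc a len)

head-< : ∀ {a len b} → a + suc len ≤ b → a < b
head-< {a} {len} le = ≤-trans (m≤m+n (suc a) len) (shift-≤ le)

inRange : ℕ → ℕ → ℕ → ℕ
inRange a zero      t = 0
inRange a (suc len) t = χ (a ≡ᵇ t) + inRange (suc a) len t

inRange-below : ∀ a len t → t < a → inRange a len t ≡ 0
inRange-below a zero t _ = refl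
inRange-below a (suc len) t t<a rewrite ≡ᵇ-≢ a t (≢-sym (<⇒≢ t<a)) =
  inRange-below (suc a) len t (m<n⇒m<1+n t<a)

inRange-above : ∀ a len t → a + len ≤ t → inRange a len t ≡ 0
inRange-above a zero t _ = refl
inRange-above a (suc len) t le rewrite ≡ᵇ-≢ a t (<⇒≢ (head-< le)) = inRange-above (suc a) len t (shift-≤ le)

inRange-inside : ∀ a len t → a ≤ t → t < a + len → inRange a len t ≡ 1
inRange-inside a zero t a≤t t<a rewrite +-identityʳ a = ⊥-elim (<⇒≱ t<a a≤t)
inRange-inside a (suc len) t a≤t t< with a ≟ t
... | yes refl rewrite ≡ᵇ-refl a = cong suc (inRange-below (suc a) len a (n<1+n a))
... | no a≢t rewrite ≡ᵇ-≢ a t a≢t = inRange-inside (suc a) len t (≤∧≢⇒< a≤t a≢t) (subst (t <_) (+-suc a len) t<)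

-- Rows are addressed by natural numbers; for t > k, row t is a junk value (the last row).
row : ∀ {k} → ℕ → Fin (suc k)
row {zero}  _       = Fin.zero
row {suc k} zero    = Fin.zero
row {suc k} (suc a) = Fin.suc (row {k} a)

toℕ-row : ∀ {k} a → a ≤ k → toℕ (row {k} a) ≡ a
toℕ-row {zero}  zero    _ = refl
toℕ-row {suc k} zero    _ = refl
toℕ-row {suc k} (suc a) (s≤s le) = cong suc (toℕ-row a le)

row-toℕ : ∀ {k} (i : Fin (suc k)) → row {k} (toℕ i) ≡ i
row-toℕ {zero}  Fin.zero    = refl
row-toℕ {suc k} Fin.zero    = refl
row-toℕ {suc k} (Fin.suc i) = cong Fin.suc (row-toℕ i)

eqB≡toℕ-≡ᵇ : (i j : Fin N) → eqB i j ≡ (toℕ i ≡ᵇ toℕ j)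
eqB≡toℕ-≡ᵇ i j with i Finₚ.≟ j
... | yes refl = sym (≡ᵇ-refl (toℕ i))
... | no i≢j   = sym (≡ᵇ-≢ (toℕ i) (toℕ j) (i≢j ∘ Finₚ.toℕ-injective))

prodAdj⇒ : ∀ {m k} (G : Graph m) (H : Graph k) i₁ j₁ i₂ j₂ → prodAdj G H (i₁ , j₁) (i₂ , j₂) ≡ true →
  (adj G i₁ i₂ ≡ true × j₁ ≡ j₂) ⊎ (i₁ ≡ i₂ × adj H j₁ j₂ ≡ true)
prodAdj⇒ G H i₁ j₁ i₂ j₂ e with ∨≡true (adj G i₁ i₂ ∧ eqB j₁ j₂) (eqB i₁ i₂ ∧ adj H j₁ j₂) e
... | inj₁ h = let i₁~i₂ , j₁≡j₂ = ∧≡true _ _ h in inj₁ (i₁~i₂ , eqB⇒≡ j₁≡j₂)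
... | inj₂ h = let i₁≡i₂ , j₁~j₂ = ∧≡true _ _ h in inj₂ (eqB⇒≡ i₁≡i₂ , j₁~j₂)

PathGraph-adj⇒ : ∀ {n} (i j : Fin n) → adj (PathGraph n) i j ≡ true → toℕ j ≡ suc (toℕ i) ⊎ toℕ i ≡ suc (toℕ j)
PathGraph-adj⇒ i j e with ∨≡true (suc (toℕ i) ≡ᵇ toℕ j) (suc (toℕ j) ≡ᵇ toℕ i) e
... | inj₁ h = inj₁ (sym (≡ᵇ-true⇒≡ _ _ h))
... | inj₂ h = inj₂ (sym (≡ᵇ-true⇒≡ _ _ h))

-- The product P_n □ T, with n = k + 4, and its restrictions to the columns of a vertex set S of T

module Construction {m} (Tr : Graph m) (k : ℕ) (r : Fin m) where

  open Walks Tr public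

  last : ℕ
  last = suc (suc (suc k))

  n : ℕ
  n = suc last

  V : Set
  V = Fin (n * m)

  Pₙ : Graph n
  Pₙ = PathGraph n

  G : Graph (n * m)
  G = Pₙ □ Tr

  cell : Fin n → Fin m → V
  cell = combine

  column : V → Fin m
  column x = proj₂ (remQuot {n} m x)

  column-cell : ∀ i u → column (cell i u) ≡ u
  column-cell i u = cong proj₂ (Finₚ.remQuot-combine i u)

  cell-decode : ∀ x → x ≡ cell (proj₁ (remQuot {n} m x)) (column x)
  cell-decode x = sym (Finₚ.combine-remQuot {n} m x)

  ∀-cell : (Q : V → Set) → (∀ i u → Q (cell i u)) → ∀ x → Q x
  ∀-cell Q f x = subst Q (sym (cell-decode x)) (f (proj₁ (remQuot {n} m x)) (column x))

  eqB-cell : ∀ i u j w → eqB (cell i u) (cell j w) ≡ eqB i j ∧ eqB u w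
  eqB-cell i u j w with i Finₚ.≟ j | u Finₚ.≟ w
  ... | yes refl | yes refl = eqB-refl (cell i u)
  ... | yes refl | no u≢w   = eqB-≢ (u≢w ∘ proj₂ ∘ Finₚ.combine-injective i u j w)
  ... | no i≢j   | _        = eqB-≢ (i≢j ∘ proj₁ ∘ Finₚ.combine-injective i u j w)

  ∀-row : (Q : Fin n → Set) → (∀ t → t ≤ last → Q (row t)) → ∀ i → Q i
  ∀-row Q f i = subst Q (row-toℕ i) (f (toℕ i) (Finₚ.toℕ≤pred[n] i))

  G[_] : (Fin m → Bool) → Graph (n * m)
  G[ S ] = record
    { adj    = λ x y → adj G x y ∧ (S (column x) ∧ S (column y))
    ; symm   = λ x y → cong₂ _∧_ (symm G x y) (Bool.∧-comm (S (column x)) (S (column y)))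
    ; irrefl = λ x → cong (_∧ (S (column x) ∧ S (column x))) (irrefl G x)
    }

  adj-G[]-cell : ∀ S i u j w → adj G[ S ] (cell i u) (cell j w) ≡ prodAdj Pₙ Tr (i , u) (j , w) ∧ (S u ∧ S w)
  adj-G[]-cell S i u j w = cong₂ (λ p q → prodAdj Pₙ Tr p q ∧ (S (proj₂ p) ∧ S (proj₂ q)))
    (Finₚ.remQuot-combine i u) (Finₚ.remQuot-combine j w)

  adj-G[]⇒columns : ∀ S x y → Adj G[ S ] x y → T (S (column x)) × T (S (column y))
  adj-G[]⇒columns S x y e with adj G x y | S (column x) | S (column y)
  ... | true | true | true = _ , _

  G[]-mono : ∀ S S′ → (∀ v → T (S v) → T (S′ v)) → ∀ x y → Adj G[ S ] x y → Adj G[ S′ ] x y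
  G[]-mono S S′ S⊆S′ x y e with adj-G[]⇒columns S x y e
  ... | x∈S , y∈S with adj G x y | S′ (column x) in x∈S′ | S′ (column y) in y∈S′
  ... | true  | true  | true  = _
  ... | true  | false | _     = subst T x∈S′ (S⊆S′ _ x∈S)
  ... | true  | true  | false = subst T y∈S′ (S⊆S′ _ y∈S)
  ... | false | _     | _ with () ← e

  segment : Fin m → ℕ → ℕ → List V
  segmentTail : Fin m → ℕ → ℕ → List V
  segment v a len = cell (row a) v ∷ segmentTail v a len
  segmentTail v a zero      = []
  segmentTail v a (suc len) = segment v (suc a) len

  segment-last : ∀ v a len → lastOf (cell (row a) v) (segmentTail v a len) ≡ cell (row (a + len)) v
  segment-last v a zero rewrite +-identityʳ a = refl
  segment-last v a (suc len) rewrite +-suc a len = segment-last v (suc a) len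

  ∈segment : ∀ v a len {z} → z ∈ segment v a len → Σ ℕ λ t → a ≤ t × t ≤ a + len × z ≡ cell (row t) v
  ∈segment v a len (here refl) = a , ≤-refl , m≤m+n a len , refl
  ∈segment v a (suc len) (there z∈) with ∈segment v (suc a) len z∈
  ... | t , a<t , t≤ , refl = t , <⇒≤ a<t , subst (t ≤_) (sym (+-suc a len)) t≤ , refl

  ∈segment⇒column : ∀ v a len {z} → z ∈ segment v a len → column z ≡ v
  ∈segment⇒column v a len z∈ with ∈segment v a len z∈
  ... | t , _ , _ , refl = column-cell (row t) v

  cell-injectiveʳ : ∀ a b u w → a ≤ last → b ≤ last → cell (row a) u ≡ cell (row b) w → a ≡ b
  cell-injectiveʳ a b u w a≤ b≤ e =
    trans (sym (toℕ-row a a≤)) (trans (cong toℕ (proj₁ (Finₚ.combine-injective (row a) u (row b) w e))) (toℕ-row b b≤))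

  cell-injectiveᶜ : ∀ i j u w → cell i u ≡ cell j w → u ≡ w
  cell-injectiveᶜ i j u w e = proj₂ (Finₚ.combine-injective i u j w e)

  segment-unique : ∀ v a len → a + len ≤ last → Unique (segment v a len)
  segment-unique v a zero _ = [] ∷ []
  segment-unique v a (suc len) le = All.tabulate head∉ ∷ segment-unique v (suc a) len (shift-≤ le)
    where
    head∉ : ∀ {z} → z ∈ segment v (suc a) len → ¬ cell (row a) v ≡ z
    head∉ z∈ e with ∈segment v (suc a) len z∈
    ... | t , a<t , t≤ , refl = <⇒≢ a<t (cell-injectiveʳ a t v v (<⇒≤ (head-< le)) (≤-trans t≤ (shift-≤ le)) e)

  toℕ-row-suc : ∀ a → suc a ≤ last → toℕ (row {last} (suc a)) ≡ suc (toℕ (row {last} a))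
  toℕ-row-suc a le = trans (toℕ-row (suc a) le) (cong suc (sym (toℕ-row a (≤-trans (n≤1+n a) le))))

  vertical-adj : ∀ S v (i j : Fin n) → S v ≡ true → toℕ j ≡ suc (toℕ i) → Adj G[ S ] (cell i v) (cell j v)
  vertical-adj S v i j v∈S j≡1+i = subst T (sym (adj-G[]-cell S i v j v)) adjacent
    where
    adjacent : T (prodAdj Pₙ Tr (i , v) (j , v) ∧ (S v ∧ S v))
    adjacent rewrite j≡1+i | ≡ᵇ-refl (toℕ i) | eqB-refl v | v∈S = _

  horizontal-adj : ∀ S (i : Fin n) u w → S u ≡ true → S w ≡ true → Adj Tr u w → Adj G[ S ] (cell i u) (cell i w)
  horizontal-adj S i u w u∈S w∈S e = subst T (sym (adj-G[]-cell S i u i w)) adjacent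
    where
    adjacent : T (prodAdj Pₙ Tr (i , u) (i , w) ∧ (S u ∧ S w))
    adjacent rewrite eqB-refl i | T⇒≡true e | u∈S | w∈S | Bool.∨-zeroʳ (adj Pₙ i i ∧ eqB u w) = _

  segment-linked : ∀ S v a len → S v ≡ true → a + len ≤ last → Linked (Adj G[ S ]) (segment v a len)
  segment-linked S v a zero v∈S le = [-]
  segment-linked S v a (suc len) v∈S le =
    vertical-adj S v (row a) (row (suc a)) v∈S (toℕ-row-suc a (head-< le))
    ∷ segment-linked S v (suc a) len v∈S (shift-≤ le)

  vertical-sameEdge-≡ᵇ : ∀ a t → ((a ≡ᵇ t) ∧ (suc a ≡ᵇ suc t)) ∨ ((a ≡ᵇ suc t) ∧ (suc a ≡ᵇ t)) ≡ (a ≡ᵇ t)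
  vertical-sameEdge-≡ᵇ a t with a ≡ᵇ t
  ... | true = refl
  ... | false with a ≡ᵇ suc t in e₁ | suc a ≡ᵇ t in e₂
  ...   | false | _     = refl
  ...   | true  | false = refl
  ...   | true  | true  = ⊥-elim (m≢2+m (trans (sym (≡ᵇ-true⇒≡ (suc a) t e₂)) (cong suc (≡ᵇ-true⇒≡ a (suc t) e₁))))
    where
    m≢2+m : ∀ {m} → ¬ m ≡ suc (suc m)
    m≢2+m {zero} ()
    m≢2+m {suc m} e = m≢2+m (suc-injective e)

  eqB-cell-row : ∀ a v (i : Fin n) w → a ≤ last → eqB (cell (row a) v) (cell i w) ≡ ((a ≡ᵇ toℕ i) ∧ eqB v w)
  eqB-cell-row a v i w le rewrite eqB-cell (row a) v i w | eqB≡toℕ-≡ᵇ (row a) i | toℕ-row a le = refl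

  traversals-∉ : ∀ (x y : V) L → x ∉ L → traversals x y L ≡ 0
  traversals-∉ x y [] _ = refl
  traversals-∉ x y (a ∷ []) _ = refl
  traversals-∉ x y (a ∷ b ∷ l) x∉ = cong₂ _+_ (cong χ not-x) (traversals-∉ x y (b ∷ l) (x∉ ∘ there))
    where
    not-x : sameEdge x y (a , b) ≡ false
    not-x rewrite eqB-≢ {a = a} {b = x} (x∉ ∘ here ∘ sym)
      | eqB-≢ {a = b} {b = x} (x∉ ∘ there ∘ here ∘ sym) | Bool.∧-zeroʳ (eqB a y) = refl

  traversals-segment : ∀ v (i j : Fin n) a len → toℕ j ≡ suc (toℕ i) → a + len ≤ last →
    traversals (cell i v) (cell j v) (segment v a len) ≡ inRange a len (toℕ i)
  traversals-segment v i j a zero e le = refl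
  traversals-segment v i j a (suc len) e le =
    cong₂ _+_ (cong χ first-step) (traversals-segment v i j (suc a) len e (shift-≤ le))
    where
    a≤ : a ≤ last
    a≤ = <⇒≤ (head-< le)
    first-step : sameEdge (cell i v) (cell j v) (cell (row a) v , cell (row (suc a)) v) ≡ (a ≡ᵇ toℕ i)
    first-step rewrite eqB-cell-row a v i v a≤ | eqB-cell-row (suc a) v j v (head-< le)
      | eqB-cell-row a v j v a≤ | eqB-cell-row (suc a) v i v (head-< le)
      | eqB-refl v | Bool.∧-identityʳ (a ≡ᵇ toℕ i) | Bool.∧-identityʳ (a ≡ᵇ toℕ j) | e
      | Bool.∧-identityʳ (suc a ≡ᵇ suc (toℕ i)) | Bool.∧-identityʳ (suc a ≡ᵇ toℕ i) = vertical-sameEdge-≡ᵇ a (toℕ i)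

  sameEdge-rung : ∀ p ℓ (i : Fin n) a → ¬ p ≡ ℓ → a ≤ last →
    sameEdge (cell i p) (cell i ℓ) (cell (row a) p , cell (row a) ℓ) ≡ (a ≡ᵇ toℕ i)
  sameEdge-rung p ℓ i a p≢ℓ a≤ rewrite eqB-cell-row a p i p a≤ | eqB-cell-row a ℓ i ℓ a≤
    | eqB-cell-row a p i ℓ a≤ | eqB-cell-row a ℓ i p a≤ | eqB-refl p | eqB-refl ℓ | eqB-≢ p≢ℓ | eqB-≢ (≢-sym p≢ℓ)
    with a ≡ᵇ toℕ i
  ... | true  = refl
  ... | false = refl

  sameEdge-rung-vertical : ∀ p ℓ (i j : Fin n) a → ¬ p ≡ ℓ → a ≤ last →
    sameEdge (cell i ℓ) (cell j ℓ) (cell (row a) p , cell (row a) ℓ) ≡ false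
  sameEdge-rung-vertical p ℓ i j a p≢ℓ a≤ rewrite eqB-cell-row a p i ℓ a≤ | eqB-cell-row a p j ℓ a≤ | eqB-≢ p≢ℓ
    | Bool.∧-zeroʳ (a ≡ᵇ toℕ i) | Bool.∧-zeroʳ (a ≡ᵇ toℕ j) = refl

  eqB-cell-rows : ∀ a t u w → a ≤ last → t ≤ last → eqB (cell (row a) u) (cell (row t) w) ≡ ((a ≡ᵇ t) ∧ eqB u w)
  eqB-cell-rows a t u w a≤ t≤ rewrite eqB-cell-row a u (row t) w a≤ | toℕ-row t t≤ = refl

  χ-eqB-cell-column-≢ : ∀ a t u w → ¬ u ≡ w → χ (eqB (cell (row a) u) (cell (row t) w)) ≡ 0
  χ-eqB-cell-column-≢ a t u w u≢w = χ-eqB-≢ (u≢w ∘ cell-injectiveᶜ (row a) (row t) u w)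

  isEndRow : Fin n → Bool
  isEndRow i = (toℕ i ≡ᵇ 0) ∨ (toℕ i ≡ᵇ last)

  isEndRow-row : ∀ t → t ≤ last → isEndRow (row t) ≡ ((t ≡ᵇ 0) ∨ (t ≡ᵇ last))
  isEndRow-row t t≤ rewrite toℕ-row t t≤ = refl

  data RowPosition (t : ℕ) : Set where
    first    : t ≡ 0 → RowPosition t
    final    : t ≡ last → RowPosition t
    interior : 1 ≤ t → t < last → RowPosition t

  rowPosition : ∀ t → t ≤ last → RowPosition t
  rowPosition zero _ = first refl
  rowPosition (suc t) t≤ with suc t ≟ last
  ... | yes e = final e
  ... | no ne = interior (s≤s z≤n) (≤∧≢⇒< t≤ ne)

  -- par v says which copies of v end a path: the interior ones (par v = true) or the two end rows.
  expectedEnds : (Fin m → Bool) → (Fin m → Bool) → Fin n → Fin m → ℕ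
  expectedEnds S par i v = χ (S v ∧ (par v xor isEndRow i))

  record Invariant (S par : Fin m → Bool) (ps : List (List V)) : Set where
    field
      decomposition : IsPathDecomposition G[ S ] ps
      ends-exact    : ∀ i v → endCount (cell i v) ps ≡ expectedEnds S par i v
      rooted        : ∀ v → T (S v) → Walk S r v

  ∈path⇒column∈ : ∀ S P z → IsPath G[ S ] P → z ∈ P → T (S (column z))
  ∈path⇒column∈ S P z (len , _ , lk) z∈ with ∈-Linked⇒neighbour lk len z∈
  ... | w , inj₁ e = proj₁ (adj-G[]⇒columns S z w e)
  ... | w , inj₂ e = proj₂ (adj-G[]⇒columns S w z e)

  Fresh-outside : ∀ S ps z → All (IsPath G[ S ]) ps → S (column z) ≡ false → Fresh z ps
  Fresh-outside S [] z [] _ = []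
  Fresh-outside S (P ∷ ps) z (ip ∷ ips) z∉S =
    (λ z∈ → subst T z∉S (∈path⇒column∈ S P z ip z∈)) ∷ Fresh-outside S ps z ips z∉S

  IsPath-G[]-mono : ∀ S S′ → (∀ v → T (S v) → T (S′ v)) → ∀ P → IsPath G[ S ] P → IsPath G[ S′ ] P
  IsPath-G[]-mono S S′ S⊆S′ P (len , u , lk) = len , u , Linked.map (G[]-mono S S′ S⊆S′ _ _) lk

  module LeafStep (S par : Fin m → Bool) (ps : List (List V)) (p ℓ : Fin m)
                  (p∈S : S p ≡ true) (ℓ∉S : S ℓ ≡ false) (p~ℓ : Adj Tr p ℓ)
                  (ℓ-leaf : ∀ q → S q ≡ true → Adj Tr ℓ q → q ≡ p) (inv : Invariant S par ps) where

    open Invariant inv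

    S⁺ : Fin m → Bool
    S⁺ v = S v ∨ eqB v ℓ

    par⁺ : Fin m → Bool
    par⁺ v = if eqB v ℓ then true else (eqB v p xor par v)

    p≢ℓ : ¬ p ≡ ℓ
    p≢ℓ e = subst T (trans (cong S e) ℓ∉S) (≡true⇒T p∈S)

    S⊆S⁺ : ∀ v → T (S v) → T (S⁺ v)
    S⊆S⁺ v v∈S rewrite T⇒≡true v∈S = _

    p∈S⁺ : S⁺ p ≡ true
    p∈S⁺ rewrite p∈S = refl

    ℓ∈S⁺ : S⁺ ℓ ≡ true
    ℓ∈S⁺ rewrite ℓ∉S | eqB-refl ℓ = refl

    G⁺ : Graph (n * m)
    G⁺ = G[ S⁺ ]

    rung : ∀ i → Adj G⁺ (cell i p) (cell i ℓ)
    rung i = horizontal-adj S⁺ i p ℓ p∈S⁺ ℓ∈S⁺ p~ℓ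

    rung′ : ∀ i → Adj G⁺ (cell i ℓ) (cell i p)
    rung′ i = subst T (symm G⁺ (cell i p) (cell i ℓ)) (rung i)

    vertical : ∀ (i j : Fin n) → toℕ j ≡ suc (toℕ i) → Adj G⁺ (cell i ℓ) (cell j ℓ)
    vertical i j = vertical-adj S⁺ ℓ i j ℓ∈S⁺

    ips : All (IsPath G[ S ]) ps
    ips = proj₁ decomposition

    ips⁺ : All (IsPath G⁺) ps
    ips⁺ = All.map (IsPath-G[]-mono S S⁺ S⊆S⁺ _) ips

    fresh-ℓ : ∀ i → Fresh (cell i ℓ) ps
    fresh-ℓ i = Fresh-outside S ps (cell i ℓ) ips (trans (cong S (column-cell i ℓ)) ℓ∉S)

    cellₚ≢cellₗ : ∀ i j → ¬ cell i p ≡ cell j ℓ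
    cellₚ≢cellₗ i j e = p≢ℓ (cell-injectiveᶜ i j p ℓ e)

    cell-row-≢ : ∀ t t′ u u′ → t ≤ last → t′ ≤ last → ¬ t ≡ t′ → ¬ cell (row t) u ≡ cell (row t′) u′
    cell-row-≢ t t′ u u′ t≤ t′≤ t≢t′ = t≢t′ ∘ cell-injectiveʳ t t′ u u′ t≤ t′≤

    addRungs : ℕ → ℕ → List (List V) → List (List V)
    addRungs a zero      qs = qs
    addRungs a (suc len) qs = attach (cell (row a) p) (cell (row a) ℓ ∷ []) (addRungs (suc a) len qs)

    rungTraversals : V → V → ℕ → ℕ → ℕ
    rungTraversals u v a zero      = 0
    rungTraversals u v a (suc len) = traversals u v (cell (row a) p ∷ cell (row a) ℓ ∷ []) + rungTraversals u v (suc a) len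

    ∑traversals-addRungs : ∀ u v a len qs →
      ∑ (addRungs a len qs) (traversals u v) ≡ ∑ qs (traversals u v) + rungTraversals u v a len
    ∑traversals-addRungs u v a zero qs = sym (+-identityʳ _)
    ∑traversals-addRungs u v a (suc len) qs
      rewrite ∑traversals-attach u v (cell (row a) p) (cell (row a) ℓ ∷ []) (addRungs (suc a) len qs)
            | ∑traversals-addRungs u v (suc a) len qs =
      lemma (∑ qs (traversals u v)) (rungTraversals u v (suc a) len) (traversals u v (cell (row a) p ∷ cell (row a) ℓ ∷ []))
      where
      lemma : ∀ a b c → a + b + c ≡ a + (c + b)
      lemma = solve-∀

    Avoids : V → ℕ → ℕ → Set
    Avoids z a len = ∀ t → a ≤ t → t < a + len → ¬ z ≡ cell (row t) p × ¬ z ≡ cell (row t) ℓ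

    Avoids-suc : ∀ z a len → Avoids z a (suc len) → Avoids z (suc a) len
    Avoids-suc z a len avoids t a<t t< = avoids t (<⇒≤ a<t) (subst (t <_) (sym (+-suc a len)) t<)

    Avoids-head : ∀ z a len → Avoids z a (suc len) → ¬ z ≡ cell (row a) p × ¬ z ≡ cell (row a) ℓ
    Avoids-head z a len avoids = avoids a ≤-refl (head-< ≤-refl)

    Avoids-row : ∀ (i : Fin n) u a len → a + len ≤ n → (toℕ i < a ⊎ a + len ≤ toℕ i) → Avoids (cell i u) a len
    Avoids-row i u a len bound outside t a≤t t< = (other-row ∘ row-of p) , (other-row ∘ row-of ℓ)
      where
      t≤ : t ≤ last
      t≤ = ≤-pred (≤-trans t< bound)
      row-of : ∀ w → cell i u ≡ cell (row t) w → toℕ i ≡ t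
      row-of w e = trans (cong toℕ (proj₁ (Finₚ.combine-injective i u (row t) w e))) (toℕ-row t t≤)
      other-row : ¬ toℕ i ≡ t
      other-row refl = [ (λ i<a → <⇒≱ i<a a≤t) , (λ ≤i → <⇒≱ t< ≤i) ]′ outside

    Avoids-column : ∀ (i : Fin n) u a len → ¬ u ≡ p → ¬ u ≡ ℓ → Avoids (cell i u) a len
    Avoids-column i u a len u≢p u≢ℓ t _ _ = u≢p ∘ cell-injectiveᶜ i (row t) u p , u≢ℓ ∘ cell-injectiveᶜ i (row t) u ℓ

    Avoids-below : ∀ (t : ℕ) u len → suc t + len ≤ n → Avoids (cell (row t) u) (suc t) len
    Avoids-below t u len bound =
      Avoids-row (row t) u (suc t) len bound (inj₁ (s≤s (≤-reflexive (toℕ-row t (≤-pred (≤-trans (m≤m+n (suc t) len) bound))))))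

    Fresh-addRungs : ∀ a len qs z → Fresh z qs → Avoids z a len → Fresh z (addRungs a len qs)
    Fresh-addRungs a zero qs z fresh _ = fresh
    Fresh-addRungs a (suc len) qs z fresh avoids =
      Fresh-attach z (cell (row a) p) (cell (row a) ℓ ∷ []) (addRungs (suc a) len qs)
        (Fresh-addRungs (suc a) len qs z fresh (Avoids-suc z a len avoids))
        (λ { (here e) → proj₁ (Avoids-head z a len avoids) e ; (there (here e)) → proj₂ (Avoids-head z a len avoids) e })

    endCount-addRungs-elsewhere : ∀ a len qs z → Avoids z a len → endCount z (addRungs a len qs) ≡ endCount z qs
    endCount-addRungs-elsewhere a zero qs z _ = refl
    endCount-addRungs-elsewhere a (suc len) qs z avoids = trans
      (endCount-attach-elsewhere z (cell (row a) p) (cell (row a) ℓ ∷ []) (addRungs (suc a) len qs)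
        (proj₁ (Avoids-head z a len avoids)) (proj₂ (Avoids-head z a len avoids)))
      (endCount-addRungs-elsewhere (suc a) len qs z (Avoids-suc z a len avoids))

    IsPath-addRungs : ∀ a len qs → a + len ≤ n → All (IsPath G⁺) qs →
      (∀ t → a ≤ t → t < a + len → Fresh (cell (row t) ℓ) qs) → All (IsPath G⁺) (addRungs a len qs)
    IsPath-addRungs a zero qs _ ips _ = ips
    IsPath-addRungs a (suc len) qs bound ips fresh =
      IsPath-attach G⁺ (cell (row a) p) (cell (row a) ℓ ∷ []) (addRungs (suc a) len qs)
        (IsPath-addRungs (suc a) len qs (shift-≤ bound) ips (λ t a<t t< → fresh t (<⇒≤ a<t) (subst (t <_) (sym (+-suc a len)) t<)))
        (rung (row a) ∷ [-]) ((cellₚ≢cellₗ (row a) (row a) ∷ []) ∷ ([] ∷ [])) (s≤s z≤n)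
        (λ { (here refl) → Fresh-addRungs (suc a) len qs (cell (row a) ℓ) (fresh a ≤-refl (head-< ≤-refl))
                              (Avoids-below a ℓ len (shift-≤ bound)) })

    endCount-addRungs-p : ∀ a len qs t → a ≤ t → t < a + len → a + len ≤ n → endCount (cell (row t) p) qs ≤ 1 →
      endCount (cell (row t) p) (addRungs a len qs) + endCount (cell (row t) p) qs ≡ 1
    endCount-addRungs-p a zero qs t a≤t t< _ _ rewrite +-identityʳ a = ⊥-elim (<⇒≱ t< a≤t)
    endCount-addRungs-p a (suc len) qs t a≤t t< bound ≤1 with t ≟ a
    ... | yes refl =
      subst (λ e → endCount (cell (row t) p) (addRungs t (suc len) qs) + e ≡ 1) below
        (endCount-attach-joined (cell (row t) p) (cell (row t) ℓ ∷ []) (addRungs (suc t) len qs)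
          (≢-sym (cellₚ≢cellₗ (row t) (row t))) (subst (_≤ 1) (sym below) ≤1))
      where
      below : endCount (cell (row t) p) (addRungs (suc t) len qs) ≡ endCount (cell (row t) p) qs
      below = endCount-addRungs-elsewhere (suc t) len qs (cell (row t) p) (Avoids-below t p len (shift-≤ bound))
    ... | no t≢a = trans (cong (_+ endCount (cell (row t) p) qs)
          (endCount-attach-elsewhere (cell (row t) p) (cell (row a) p) (cell (row a) ℓ ∷ []) (addRungs (suc a) len qs)
             (cell-row-≢ t a p p t≤ (≤-trans a≤t t≤) t≢a) (cellₚ≢cellₗ (row t) (row a))))
        (endCount-addRungs-p (suc a) len qs t (≤∧≢⇒< a≤t (≢-sym t≢a)) (subst (t <_) (+-suc a len) t<) (shift-≤ bound) ≤1)
      where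
      t≤ : t ≤ last
      t≤ = ≤-pred (≤-trans t< bound)

    endCount-addRungs-ℓ : ∀ a len qs t → a ≤ t → t < a + len → a + len ≤ n →
      endCount (cell (row t) ℓ) (addRungs a len qs) ≡ endCount (cell (row t) ℓ) qs + 1
    endCount-addRungs-ℓ a zero qs t a≤t t< _ rewrite +-identityʳ a = ⊥-elim (<⇒≱ t< a≤t)
    endCount-addRungs-ℓ a (suc len) qs t a≤t t< bound with t ≟ a
    ... | yes refl = trans
      (endCount-attach-newEnd (cell (row t) p) (cell (row t) ℓ ∷ []) (addRungs (suc t) len qs) (≢-sym (cellₚ≢cellₗ (row t) (row t))))
      (cong (_+ 1) (endCount-addRungs-elsewhere (suc t) len qs (cell (row t) ℓ) (Avoids-below t ℓ len (shift-≤ bound))))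
    ... | no t≢a = trans
      (endCount-attach-elsewhere (cell (row t) ℓ) (cell (row a) p) (cell (row a) ℓ ∷ []) (addRungs (suc a) len qs)
        (≢-sym (cellₚ≢cellₗ (row a) (row t))) (cell-row-≢ t a ℓ ℓ t≤ (≤-trans a≤t t≤) t≢a))
      (endCount-addRungs-ℓ (suc a) len qs t (≤∧≢⇒< a≤t (≢-sym t≢a)) (subst (t <_) (+-suc a len) t<) (shift-≤ bound))
      where
      t≤ : t ≤ last
      t≤ = ≤-pred (≤-trans t< bound)

    rungTraversals-rung : ∀ (i : Fin n) a len → a + len ≤ n → rungTraversals (cell i p) (cell i ℓ) a len ≡ inRange a len (toℕ i)
    rungTraversals-rung i a zero _ = refl
    rungTraversals-rung i a (suc len) bound = cong₂ _+_
      (trans (+-identityʳ _) (cong χ (sameEdge-rung p ℓ i a p≢ℓ (≤-pred (head-< bound)))))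
      (rungTraversals-rung i (suc a) len (shift-≤ bound))

    rungTraversals-vertical : ∀ (i j : Fin n) a len → a + len ≤ n → rungTraversals (cell i ℓ) (cell j ℓ) a len ≡ 0
    rungTraversals-vertical i j a zero _ = refl
    rungTraversals-vertical i j a (suc len) bound = cong₂ _+_
      (trans (+-identityʳ _) (cong χ (sameEdge-rung-vertical p ℓ i j a p≢ℓ (≤-pred (head-< bound)))))
      (rungTraversals-vertical i j (suc a) len (shift-≤ bound))

    -- Edges of the old graph are not traversed by a new path, since each of its steps meets column ℓ.

    Outside : V → Set
    Outside z = S (column z) ≡ false

    Touches : V × V → Set
    Touches s = Outside (proj₁ s) ⊎ Outside (proj₂ s)

    sameEdge-old : ∀ x y a b → T (S (column x)) → T (S (column y)) → Touches (a , b) → sameEdge x y (a , b) ≡ false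
    sameEdge-old x y a b x∈S y∈S touches with sameEdge x y (a , b) in e
    ... | false = refl
    ... | true with sameEdge⇒ x y a b e | touches
    ...   | inj₁ (refl , refl) | inj₁ out = ⊥-elim (subst T out x∈S)
    ...   | inj₁ (refl , refl) | inj₂ out = ⊥-elim (subst T out y∈S)
    ...   | inj₂ (refl , refl) | inj₁ out = ⊥-elim (subst T out y∈S)
    ...   | inj₂ (refl , refl) | inj₂ out = ⊥-elim (subst T out x∈S)

    traversals-old : ∀ x y L → T (S (column x)) → T (S (column y)) → All Touches (steps L) → traversals x y L ≡ 0
    traversals-old x y L x∈S y∈S touches =
      trans (∑-congAll (All.map (λ {s} t → cong χ (sameEdge-old x y (proj₁ s) (proj₂ s) x∈S y∈S t)) touches)) (∑-zero (steps L))

    All-Touches : ∀ L → All Outside L → All Touches (steps L)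
    All-Touches [] _ = []
    All-Touches (a ∷ []) _ = []
    All-Touches (a ∷ b ∷ l) (out ∷ outs) = inj₁ out ∷ All-Touches (b ∷ l) outs

    Touches-rung : ∀ h a l → All Outside (a ∷ l) → All Touches (steps (h ∷ a ∷ l))
    Touches-rung h a l outs@(out ∷ _) = inj₂ out ∷ All-Touches (a ∷ l) outs

    Touches-++ : ∀ a l t → All Outside (a ∷ l) → All Touches (steps ((a ∷ l) ++ t ∷ []))
    Touches-++ a [] t (out ∷ _) = inj₁ out ∷ []
    Touches-++ a (b ∷ l) t (out ∷ outs) = inj₁ out ∷ Touches-++ b l t outs

    Touches-detour : ∀ h a l t → All Outside (a ∷ l) → All Touches (steps (h ∷ ((a ∷ l) ++ t ∷ [])))
    Touches-detour h a l t outs@(out ∷ _) = inj₂ out ∷ Touches-++ a l t outs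

    cell-ℓ-outside : ∀ i → Outside (cell i ℓ)
    cell-ℓ-outside i = trans (cong S (column-cell i ℓ)) ℓ∉S

    segment-ℓ-outside : ∀ a len → All Outside (segment ℓ a len)
    segment-ℓ-outside a len = All.tabulate (λ z∈ → trans (cong S (∈segment⇒column ℓ a len z∈)) ℓ∉S)

    rungTraversals-old : ∀ x y a len → T (S (column x)) → T (S (column y)) → rungTraversals x y a len ≡ 0
    rungTraversals-old x y a zero _ _ = refl
    rungTraversals-old x y a (suc len) x∈S y∈S = cong₂ _+_
      (traversals-old x y (cell (row a) p ∷ cell (row a) ℓ ∷ []) x∈S y∈S (Touches-rung _ _ [] (cell-ℓ-outside (row a) ∷ [])))
      (rungTraversals-old x y (suc a) len x∈S y∈S)

    data EdgeKind (x y : V) : Set where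
      old      : Adj G[ S ] x y → EdgeKind x y
      downward : ∀ i j → x ≡ cell i ℓ → y ≡ cell j ℓ → toℕ j ≡ suc (toℕ i) → EdgeKind x y
      upward   : ∀ i j → y ≡ cell i ℓ → x ≡ cell j ℓ → toℕ j ≡ suc (toℕ i) → EdgeKind x y
      rungₗ    : ∀ i → x ≡ cell i p → y ≡ cell i ℓ → EdgeKind x y
      rungᵣ    : ∀ i → y ≡ cell i p → x ≡ cell i ℓ → EdgeKind x y

    S⁺∖S⇒ℓ : ∀ v → S⁺ v ≡ true → S v ≡ false → v ≡ ℓ
    S⁺∖S⇒ℓ v v∈S⁺ v∉S rewrite v∉S = eqB⇒≡ v∈S⁺

    one-is-ℓ : ∀ u w → S⁺ u ∧ S⁺ w ≡ true → S u ∧ S w ≡ false → u ≡ ℓ ⊎ w ≡ ℓ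
    one-is-ℓ u w both∈S⁺ ¬both∈S with ∧≡true (S⁺ u) (S⁺ w) both∈S⁺
    ... | u∈S⁺ , w∈S⁺ with S u
    ...   | false = inj₁ (eqB⇒≡ u∈S⁺)
    ...   | true  = inj₂ (S⁺∖S⇒ℓ w w∈S⁺ ¬both∈S)

    neighbour-of-ℓ : ∀ w → S⁺ w ≡ true → Adj Tr ℓ w → w ≡ p
    neighbour-of-ℓ w w∈S⁺ ℓ~w = ℓ-leaf w w∈S ℓ~w
      where
      w∈S : S w ≡ true
      w∈S = trans (sym (Bool.∨-identityʳ (S w))) (subst (λ b → S w ∨ b ≡ true) (eqB-≢ (≢-sym (adj⇒≢ Tr ℓ~w))) w∈S⁺)

    vertical-kind : ∀ i j → toℕ j ≡ suc (toℕ i) ⊎ toℕ i ≡ suc (toℕ j) → EdgeKind (cell i ℓ) (cell j ℓ)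
    vertical-kind i j (inj₁ j≡1+i) = downward i j refl refl j≡1+i
    vertical-kind i j (inj₂ i≡1+j) = upward j i refl refl i≡1+j

    classify-cells : ∀ i u j w → Adj G⁺ (cell i u) (cell j w) → EdgeKind (cell i u) (cell j w)
    classify-cells i u j w e with ∧≡true _ _ (T⇒≡true (subst T (adj-G[]-cell S⁺ i u j w) e))
    ... | adjacent , both∈S⁺ with S u ∧ S w in both∈S
    ... | true = old (subst T (sym (adj-G[]-cell S i u j w)) (≡true⇒T (cong₂ _∧_ adjacent both∈S)))
    ... | false with prodAdj⇒ Pₙ Tr i u j w adjacent | one-is-ℓ u w both∈S⁺ both∈S
    ...   | inj₁ (i~j , refl) | inj₁ refl = vertical-kind i j (PathGraph-adj⇒ i j i~j)
    ...   | inj₁ (i~j , refl) | inj₂ refl = vertical-kind i j (PathGraph-adj⇒ i j i~j)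
    ...   | inj₂ (refl , u~w) | inj₁ refl =
      rungᵣ i (cong (cell i) (neighbour-of-ℓ w (proj₂ (∧≡true _ _ both∈S⁺)) (≡true⇒T u~w))) refl
    ...   | inj₂ (refl , u~w) | inj₂ refl =
      rungₗ i (cong (cell i) (neighbour-of-ℓ u (proj₁ (∧≡true _ _ both∈S⁺)) (subst T (symm Tr u ℓ) (≡true⇒T u~w)))) refl

    classify : ∀ x y → Adj G⁺ x y → EdgeKind x y
    classify = ∀-cell (λ x → ∀ y → Adj G⁺ x y → EdgeKind x y) λ i u →
               ∀-cell (λ y → Adj G⁺ (cell i u) y → EdgeKind (cell i u) y) λ j w → classify-cells i u j w

    adj-ℓ-old : ∀ i (z : V) → adj G[ S ] (cell i ℓ) z ≡ false
    adj-ℓ-old i z = trans (cong (λ b → adj G (cell i ℓ) z ∧ (S b ∧ S (column z))) (column-cell i ℓ))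
      (trans (cong (λ b → adj G (cell i ℓ) z ∧ (b ∧ S (column z))) ℓ∉S) (Bool.∧-zeroʳ (adj G (cell i ℓ) z)))

    ∑traversals-ℓ : ∀ i (z : V) → ∑ ps (traversals (cell i ℓ) z) ≡ 0
    ∑traversals-ℓ i z = trans (sym (uses≡∑traversals (cell i ℓ) z ps)) (uses-nonedge G[ S ] (cell i ℓ) z ps ips (adj-ℓ-old i z))

    ∑traversals-ℓʳ : ∀ i (z : V) → ∑ ps (traversals z (cell i ℓ)) ≡ 0
    ∑traversals-ℓʳ i z = trans (∑-cong ps (traversals-sym z (cell i ℓ))) (∑traversals-ℓ i z)

    uses≡1-from-added : ∀ (ps⁺ : List (List V)) (added : V → V → ℕ) →
      (∀ x y → ∑ ps⁺ (traversals x y) ≡ ∑ ps (traversals x y) + added x y) →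
      (∀ x y → T (S (column x)) → T (S (column y)) → added x y ≡ 0) →
      (∀ (i j : Fin n) → toℕ j ≡ suc (toℕ i) → added (cell i ℓ) (cell j ℓ) ≡ 1) →
      (∀ i → added (cell i p) (cell i ℓ) ≡ 1) →
      ∀ x y → Adj G⁺ x y → uses x y ps⁺ ≡ 1
    uses≡1-from-added ps⁺ added total on-old on-vertical on-rung x y e =
      trans (uses≡∑traversals x y ps⁺) (once (classify x y e))
      where
      vertical-once : ∀ i j → toℕ j ≡ suc (toℕ i) → ∑ ps⁺ (traversals (cell i ℓ) (cell j ℓ)) ≡ 1
      vertical-once i j j≡1+i = trans (total _ _) (cong₂ _+_ (∑traversals-ℓ i (cell j ℓ)) (on-vertical i j j≡1+i))
      rung-once : ∀ i → ∑ ps⁺ (traversals (cell i p) (cell i ℓ)) ≡ 1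
      rung-once i = trans (total _ _) (cong₂ _+_ (∑traversals-ℓʳ i (cell i p)) (on-rung i))
      once : EdgeKind x y → ∑ ps⁺ (traversals x y) ≡ 1
      once (old x~y) = trans (total x y) (cong₂ _+_
        (trans (sym (uses≡∑traversals x y ps)) (proj₂ decomposition x y x~y))
        (on-old x y (proj₁ (adj-G[]⇒columns S x y x~y)) (proj₂ (adj-G[]⇒columns S x y x~y))))
      once (downward i j refl refl j≡1+i) = vertical-once i j j≡1+i
      once (upward i j refl refl j≡1+i) = trans (∑-cong ps⁺ (traversals-sym (cell j ℓ) (cell i ℓ))) (vertical-once i j j≡1+i)
      once (rungₗ i refl refl) = rung-once i
      once (rungᵣ i refl refl) = trans (∑-cong ps⁺ (traversals-sym (cell i ℓ) (cell i p))) (rung-once i)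

    detour : ℕ → ℕ → List V
    detour a len = cell (row a) p ∷ (segment ℓ a len ++ cell (row (a + len)) p ∷ [])

    traversals-detour : ∀ (u v : V) a len → traversals u v (detour a len) ≡
      χ (sameEdge u v (cell (row a) p , cell (row a) ℓ)) + (traversals u v (segment ℓ a len) +
        (χ (sameEdge u v (cell (row (a + len)) ℓ , cell (row (a + len)) p)) + 0))
    traversals-detour u v a len = cong (χ (sameEdge u v (cell (row a) p , cell (row a) ℓ)) +_)
      (trans (traversals-++ u v (cell (row a) ℓ) (segmentTail ℓ a len) (cell (row (a + len)) p ∷ []))
        (cong (λ z → traversals u v (segment ℓ a len) + (χ (sameEdge u v (z , cell (row (a + len)) p)) + 0)) (segment-last ℓ a len)))

    cellₚ∉segmentₗ : ∀ (i : Fin n) a len → cell i p ∉ segment ℓ a len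
    cellₚ∉segmentₗ i a len z∈ = p≢ℓ (trans (sym (column-cell i p)) (∈segment⇒column ℓ a len z∈))

    IsPath-detour : ∀ a len → a + len ≤ last → 1 ≤ len → IsPath G⁺ (detour a len)
    IsPath-detour a len bound 1≤len = s≤s (s≤s z≤n) , (All.tabulate head∉ ∷ tail-unique) , linked
      where
      end = cell (row (a + len)) p
      head∉ : ∀ {z} → z ∈ (segment ℓ a len ++ end ∷ []) → ¬ cell (row a) p ≡ z
      head∉ z∈ refl with Mem.∈-++⁻ (segment ℓ a len) z∈
      ... | inj₁ z∈segment = cellₚ∉segmentₗ (row a) a len z∈segment
      ... | inj₂ (here e) = <⇒≢ (m<m+n a 1≤len)
                              (cell-injectiveʳ a (a + len) p p (≤-trans (m≤m+n a len) bound) bound e)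
      tail-unique : Unique (segment ℓ a len ++ end ∷ [])
      tail-unique = Unique.++⁺ (segment-unique ℓ a len bound) ([] ∷ [])
        (λ { (z∈ , here refl) → cellₚ∉segmentₗ (row (a + len)) a len z∈ })
      linked : Linked (Adj G⁺) (detour a len)
      linked = rung (row a) ∷ Linked-++ (cell (row a) ℓ) (segmentTail ℓ a len) (end ∷ [])
        (segment-linked S⁺ ℓ a len ℓ∈S⁺ bound)
        (subst (λ z → Linked (Adj G⁺) (z ∷ end ∷ [])) (sym (segment-last ℓ a len)) (rung′ (row (a + len)) ∷ [-]))

    traversals-detour-old : ∀ x y a len → T (S (column x)) → T (S (column y)) → traversals x y (detour a len) ≡ 0
    traversals-detour-old x y a len x∈S y∈S = traversals-old x y (detour a len) x∈S y∈S
      (Touches-detour (cell (row a) p) (cell (row a) ℓ) (segmentTail ℓ a len) (cell (row (a + len)) p) (segment-ℓ-outside a len))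

    traversals-detour-vertical : ∀ (i j : Fin n) a len → toℕ j ≡ suc (toℕ i) → a + len ≤ last →
      traversals (cell i ℓ) (cell j ℓ) (detour a len) ≡ inRange a len (toℕ i)
    traversals-detour-vertical i j a len j≡1+i bound rewrite traversals-detour (cell i ℓ) (cell j ℓ) a len
      | sameEdge-rung-vertical p ℓ i j a p≢ℓ (≤-trans (m≤m+n a len) bound)
      | sameEdge-swap (cell i ℓ) (cell j ℓ) (cell (row (a + len)) ℓ) (cell (row (a + len)) p)
      | sameEdge-rung-vertical p ℓ i j (a + len) p≢ℓ bound
      | traversals-segment ℓ i j a len j≡1+i bound = +-identityʳ _

    traversals-detour-rung : ∀ (i : Fin n) a len → a + len ≤ last →
      traversals (cell i p) (cell i ℓ) (detour a len) ≡ χ (a ≡ᵇ toℕ i) + χ (a + len ≡ᵇ toℕ i)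
    traversals-detour-rung i a len bound rewrite traversals-detour (cell i p) (cell i ℓ) a len
      | sameEdge-rung p ℓ i a p≢ℓ (≤-trans (m≤m+n a len) bound)
      | sameEdge-swap (cell i p) (cell i ℓ) (cell (row (a + len)) ℓ) (cell (row (a + len)) p)
      | sameEdge-rung p ℓ i (a + len) p≢ℓ bound
      | traversals-∉ (cell i p) (cell i ℓ) (segment ℓ a len) (cellₚ∉segmentₗ i a len)
      | +-identityʳ (χ (a + len ≡ᵇ toℕ i)) = refl

    ends-detour : ∀ z a len → ends z (detour a len) ≡ χ (eqB (cell (row a) p) z) + χ (eqB (cell (row (a + len)) p) z)
    ends-detour z a len = cong (λ w → χ (eqB (cell (row a) p) z) + χ (eqB w z))
      (lastOf-++ (cell (row a) p) (segment ℓ a len) (cell (row (a + len)) p ∷ []))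

    expectedEnds⁺-other : ∀ i v → ¬ v ≡ p → ¬ v ≡ ℓ → expectedEnds S⁺ par⁺ i v ≡ expectedEnds S par i v
    expectedEnds⁺-other i v v≢p v≢ℓ rewrite eqB-≢ v≢p | eqB-≢ v≢ℓ | Bool.∨-identityʳ (S v) = refl

    expectedEnds⁺-ℓ : ∀ i → expectedEnds S⁺ par⁺ i ℓ ≡ χ (not (isEndRow i))
    expectedEnds⁺-ℓ i rewrite eqB-refl ℓ | ℓ∉S = refl

    expectedEnds⁺-p : ∀ i → expectedEnds S⁺ par⁺ i p ≡ χ (not (par p) xor isEndRow i)
    expectedEnds⁺-p i rewrite eqB-≢ p≢ℓ | eqB-refl p | p∈S = refl

    old-ends-p : ∀ t → t ≤ last → endCount (cell (row t) p) ps ≡ χ (par p xor ((t ≡ᵇ 0) ∨ (t ≡ᵇ last)))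
    old-ends-p t t≤ rewrite ends-exact (row t) p | p∈S | isEndRow-row t t≤ = refl

    old-ends-ℓ : ∀ t → endCount (cell (row t) ℓ) ps ≡ 0
    old-ends-ℓ t rewrite ends-exact (row t) ℓ | ℓ∉S = refl

    ends-detour-p : ∀ a len t → a + len ≤ last → t ≤ last →
      ends (cell (row t) p) (detour a len) ≡ χ (a ≡ᵇ t) + χ (a + len ≡ᵇ t)
    ends-detour-p a len t bound t≤ rewrite ends-detour (cell (row t) p) a len
      | eqB-cell-rows a t p p (≤-trans (m≤m+n a len) bound) t≤ | eqB-cell-rows (a + len) t p p bound t≤ | eqB-refl p
      | Bool.∧-identityʳ (a ≡ᵇ t) | Bool.∧-identityʳ (a + len ≡ᵇ t) = refl

    ends-detour-elsewhere : ∀ a len t v → ¬ v ≡ p → ends (cell (row t) v) (detour a len) ≡ 0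
    ends-detour-elsewhere a len t v v≢p rewrite ends-detour (cell (row t) v) a len
      | χ-eqB-cell-column-≢ a t p v (≢-sym v≢p) | χ-eqB-cell-column-≢ (a + len) t p v (≢-sym v≢p) = refl

    data ColumnKind (v : Fin m) : Set where
      atP       : v ≡ p → ColumnKind v
      atℓ       : v ≡ ℓ → ColumnKind v
      elsewhere : ¬ v ≡ p → ¬ v ≡ ℓ → ColumnKind v

    columnKind : ∀ v → ColumnKind v
    columnKind v with v Finₚ.≟ p | v Finₚ.≟ ℓ
    ... | yes v≡p | _       = atP v≡p
    ... | no _    | yes v≡ℓ = atℓ v≡ℓ
    ... | no v≢p  | no v≢ℓ  = elsewhere v≢p v≢ℓ

    rooted⁺ : ∀ v → T (S⁺ v) → Walk S⁺ r v
    rooted⁺ v v∈S⁺ with S v in v∈S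
    ... | true = weaken S⊆S⁺ (rooted v (≡true⇒T v∈S))
    ... | false with eqB⇒≡ {a = v} {b = ℓ} (T⇒≡true v∈S⁺)
    ...   | refl = snoc (weaken S⊆S⁺ (rooted p (≡true⇒T p∈S))) p~ℓ (≡true⇒T ℓ∈S⁺)

    -- The interior copies of p end paths: extend each of them by its rung, and let the detour
    -- (0,p),(0,ℓ),…,(last,ℓ),(last,p) cover column ℓ and the two remaining rungs.
    module InteriorEnds (par-p : par p ≡ true) where

      inner : ℕ
      inner = suc (suc k)

      rungs≤n : 1 + inner ≤ n
      rungs≤n = n≤1+n last

      withRungs : List (List V)
      withRungs = addRungs 1 inner ps

      ps⁺ : List (List V)
      ps⁺ = detour 0 last ∷ withRungs

      paths : All (IsPath G⁺) ps⁺
      paths = IsPath-detour 0 last ≤-refl (s≤s z≤n) ∷ IsPath-addRungs 1 inner ps rungs≤n ips⁺ (λ t _ _ → fresh-ℓ (row t))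

      added : V → V → ℕ
      added x y = traversals x y (detour 0 last) + rungTraversals x y 1 inner

      total : ∀ x y → ∑ ps⁺ (traversals x y) ≡ ∑ ps (traversals x y) + added x y
      total x y rewrite ∑traversals-addRungs x y 1 inner ps =
        lemma (traversals x y (detour 0 last)) (∑ ps (traversals x y)) (rungTraversals x y 1 inner)
        where
        lemma : ∀ a b c → a + (b + c) ≡ b + (a + c)
        lemma = solve-∀

      rung-once : ∀ t → t ≤ last → χ (0 ≡ᵇ t) + χ (last ≡ᵇ t) + inRange 1 inner t ≡ 1
      rung-once t t≤ with rowPosition t t≤
      ... | first refl rewrite inRange-below 1 inner 0 (s≤s z≤n) = refl
      ... | final refl rewrite ≡ᵇ-refl last | inRange-above 1 inner last ≤-refl = refl
      ... | interior 1≤t@(s≤s _) t<last rewrite ≡ᵇ-≢ last t (≢-sym (<⇒≢ t<last)) | inRange-inside 1 inner t 1≤t t<last = refl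

      once : ∀ x y → Adj G⁺ x y → uses x y ps⁺ ≡ 1
      once = uses≡1-from-added ps⁺ added total
        (λ x y x∈S y∈S → cong₂ _+_ (traversals-detour-old x y 0 last x∈S y∈S) (rungTraversals-old x y 1 inner x∈S y∈S))
        (λ i j j≡1+i → trans (cong₂ _+_ (traversals-detour-vertical i j 0 last j≡1+i ≤-refl) (rungTraversals-vertical i j 1 inner rungs≤n))
           (trans (+-identityʳ _) (inRange-inside 0 last (toℕ i) z≤n (subst (_≤ last) j≡1+i (Finₚ.toℕ≤pred[n] j)))))
        (λ i → trans (cong₂ _+_ (traversals-detour-rung i 0 last ≤-refl) (rungTraversals-rung i 1 inner rungs≤n))
           (rung-once (toℕ i) (Finₚ.toℕ≤pred[n] i)))

      Avoids-end-row : ∀ t u → RowPosition t → t ≡ 0 ⊎ t ≡ last → Avoids (cell (row t) u) 1 inner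
      Avoids-end-row t u _ (inj₁ refl) = Avoids-row (row 0) u 1 inner rungs≤n (inj₁ (s≤s z≤n))
      Avoids-end-row t u _ (inj₂ refl) = Avoids-row (row last) u 1 inner rungs≤n (inj₂ (≤-reflexive (sym (toℕ-row last ≤-refl))))

      withRungs-ends-p : ∀ t → t ≤ last → endCount (cell (row t) p) withRungs ≡ 0
      withRungs-ends-p t t≤ with rowPosition t t≤
      ... | first refl rewrite endCount-addRungs-elsewhere 1 inner ps (cell (row 0) p) (Avoids-end-row 0 p (first refl) (inj₁ refl))
        | old-ends-p 0 t≤ | par-p = refl
      ... | final refl rewrite endCount-addRungs-elsewhere 1 inner ps (cell (row last) p) (Avoids-end-row last p (final refl) (inj₂ refl))
        | old-ends-p last t≤ | par-p | ≡ᵇ-refl last = refl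
      ... | interior 1≤t@(s≤s _) t<last = +-cancelʳ-≡ 1 _ 0
        (trans (cong (endCount (cell (row t) p) withRungs +_) (sym was-end))
          (endCount-addRungs-p 1 inner ps t 1≤t t<last rungs≤n (≤-reflexive was-end)))
        where
        was-end : endCount (cell (row t) p) ps ≡ 1
        was-end rewrite old-ends-p t t≤ | par-p | ≡ᵇ-≢ t last (<⇒≢ t<last) = refl

      exact-row : ∀ t → t ≤ last → ∀ v → endCount (cell (row t) v) ps⁺ ≡ expectedEnds S⁺ par⁺ (row t) v
      exact-row t t≤ v with columnKind v
      ... | atP refl rewrite ends-detour-p 0 last t ≤-refl t≤ | withRungs-ends-p t t≤ | expectedEnds⁺-p (row t) | par-p
        | isEndRow-row t t≤ with rowPosition t t≤
      ...   | first refl = refl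
      ...   | final refl rewrite ≡ᵇ-refl last = refl
      ...   | interior (s≤s _) t<last rewrite ≡ᵇ-≢ last t (≢-sym (<⇒≢ t<last)) | ≡ᵇ-≢ t last (<⇒≢ t<last) = refl
      exact-row t t≤ v | atℓ refl rewrite ends-detour-elsewhere 0 last t ℓ (≢-sym p≢ℓ) | expectedEnds⁺-ℓ (row t)
        | isEndRow-row t t≤ with rowPosition t t≤
      ...   | first refl rewrite endCount-addRungs-elsewhere 1 inner ps (cell (row 0) ℓ) (Avoids-end-row 0 ℓ (first refl) (inj₁ refl))
        | old-ends-ℓ 0 = refl
      ...   | final refl rewrite endCount-addRungs-elsewhere 1 inner ps (cell (row last) ℓ) (Avoids-end-row last ℓ (final refl) (inj₂ refl))
        | old-ends-ℓ last | ≡ᵇ-refl last = refl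
      ...   | interior 1≤t@(s≤s _) t<last rewrite endCount-addRungs-ℓ 1 inner ps t 1≤t t<last rungs≤n | old-ends-ℓ t
        | ≡ᵇ-≢ t last (<⇒≢ t<last) = refl
      exact-row t t≤ v | elsewhere v≢p v≢ℓ rewrite ends-detour-elsewhere 0 last t v v≢p
        | endCount-addRungs-elsewhere 1 inner ps (cell (row t) v) (Avoids-column (row t) v 1 inner v≢p v≢ℓ)
        | expectedEnds⁺-other (row t) v v≢p v≢ℓ = ends-exact (row t) v

      invariant : Invariant S⁺ par⁺ ps⁺
      invariant = record
        { decomposition = paths , once
        ; ends-exact    = λ i v → ∀-row (λ i → endCount (cell i v) ps⁺ ≡ expectedEnds S⁺ par⁺ i v) (λ t t≤ → exact-row t t≤ v) i
        ; rooted        = rooted⁺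
        }

    Fresh-column-ℓ : ∀ z → column z ≡ ℓ → Fresh z ps
    Fresh-column-ℓ z e = Fresh-outside S ps z ips (trans (cong S e) ℓ∉S)

    -- Only (0,p) and (last,p) end paths: extend them by (0,ℓ),(1,ℓ) and by (last,ℓ),(penult,ℓ), let the
    -- detour (1,p),(1,ℓ),…,(penult,ℓ),(penult,p) cover the rest of column ℓ, and add the rungs of the rows
    -- strictly between 1 and penult as new paths. The two extensions are disjoint because n ≥ 4.
    module BoundaryEnds (par-p : par p ≡ false) where

      penult : ℕ
      penult = suc (suc k)

      top : List V
      top = segment ℓ 0 1

      bottom : List V
      bottom = cell (row last) ℓ ∷ cell (row penult) ℓ ∷ []

      withTop withBottom withRungs ps⁺ : List (List V)
      withTop = attach (cell (row 0) p) top ps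
      withBottom = attach (cell (row last) p) bottom withTop
      withRungs = addRungs 2 k withBottom
      ps⁺ = detour 1 (suc k) ∷ withRungs

      1≤last : 1 ≤ last
      1≤last = s≤s z≤n
      penult≤last : penult ≤ last
      penult≤last = n≤1+n penult

      rungs≤n : 2 + k ≤ n
      rungs≤n = ≤-trans (n≤1+n _) (n≤1+n _)

      bottom-step : Adj G⁺ (cell (row last) ℓ) (cell (row penult) ℓ)
      bottom-step = subst T (symm G⁺ (cell (row penult) ℓ) (cell (row last) ℓ))
              (vertical (row penult) (row last) (toℕ-row-suc penult ≤-refl))

      paths-withTop : All (IsPath G⁺) withTop
      paths-withTop = IsPath-attach G⁺ (cell (row 0) p) top ps ips⁺
        (rung (row 0) ∷ segment-linked S⁺ ℓ 0 1 ℓ∈S⁺ 1≤last)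
        (All.tabulate (λ {z} zm e → cellₚ∉segmentₗ (row 0) 0 1 (subst (_∈ top) (sym e) zm)) ∷ segment-unique ℓ 0 1 1≤last)
        (s≤s z≤n)
        (λ {z} zm → Fresh-column-ℓ z (∈segment⇒column ℓ 0 1 zm))

      cellₗ∉top : ∀ t → t ≤ last → 2 ≤ t → cell (row t) ℓ ∉ (cell (row 0) p ∷ top)
      cellₗ∉top t t≤ 2≤t (here e) = cellₚ≢cellₗ (row 0) (row t) (sym e)
      cellₗ∉top t t≤ 2≤t (there (here e)) = cell-row-≢ t 0 ℓ ℓ t≤ z≤n (λ e' → <⇒≢ (≤-trans (s≤s z≤n) 2≤t) (sym e')) e
      cellₗ∉top t t≤ 2≤t (there (there (here e))) = cell-row-≢ t 1 ℓ ℓ t≤ 1≤last (λ e' → <⇒≢ 2≤t (sym e')) e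

      paths-withBottom : All (IsPath G⁺) withBottom
      paths-withBottom = IsPath-attach G⁺ (cell (row last) p) bottom withTop paths-withTop
        (rung (row last) ∷ bottom-step ∷ [-])
        ((((λ e → cellₚ≢cellₗ (row last) (row last) e) ∷ (λ e → cellₚ≢cellₗ (row last) (row penult) e) ∷ []) ∷
          ((cell-row-≢ last penult ℓ ℓ ≤-refl penult≤last (λ e → <⇒≢ ≤-refl (sym e)) ∷ []) ∷ ([] ∷ []))))
        (s≤s z≤n)
        fresh-bottom
        where
        fresh-bottom : ∀ {z} → z ∈ bottom → Fresh z withTop
        fresh-bottom (here refl) = Fresh-attach _ (cell (row 0) p) top ps (Fresh-column-ℓ _ (column-cell (row last) ℓ)) (cellₗ∉top last ≤-refl (s≤s (s≤s z≤n)))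
        fresh-bottom (there (here refl)) = Fresh-attach _ (cell (row 0) p) top ps (Fresh-column-ℓ _ (column-cell (row penult) ℓ)) (cellₗ∉top penult penult≤last (s≤s (s≤s z≤n)))

      paths : All (IsPath G⁺) ps⁺
      paths = IsPath-detour 1 (suc k) penult≤last (s≤s z≤n) ∷ IsPath-addRungs 2 k withBottom rungs≤n paths-withBottom fresh-rung
        where
        fresh-rung : ∀ t → 2 ≤ t → t < 2 + k → Fresh (cell (row t) ℓ) withBottom
        fresh-rung t 2≤t t< = Fresh-attach _ (cell (row last) p) bottom withTop
          (Fresh-attach _ (cell (row 0) p) top ps (Fresh-column-ℓ _ (column-cell (row t) ℓ)) (cellₗ∉top t t≤ 2≤t))
          (λ { (here e) → cellₚ≢cellₗ (row last) (row t) (sym e)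
             ; (there (here e)) → cell-row-≢ t last ℓ ℓ t≤ ≤-refl (<⇒≢ (≤-trans t< (n≤1+n _))) e
             ; (there (there (here e))) → cell-row-≢ t penult ℓ ℓ t≤ penult≤last (<⇒≢ t<) e })
          where
          t≤ : t ≤ last
          t≤ = ≤-trans (<⇒≤ t<) (n≤1+n _)

      added : V → V → ℕ
      added x y = traversals x y (cell (row 0) p ∷ top) + traversals x y (cell (row last) p ∷ bottom) + rungTraversals x y 2 k + traversals x y (detour 1 (suc k))

      total : ∀ x y → ∑ ps⁺ (traversals x y) ≡ ∑ ps (traversals x y) + added x y
      total x y rewrite ∑traversals-addRungs x y 2 k withBottom | ∑traversals-attach x y (cell (row last) p) bottom withTop | ∑traversals-attach x y (cell (row 0) p) top ps =
        lemma (traversals x y (detour 1 (suc k))) (∑ ps (traversals x y)) (traversals x y (cell (row 0) p ∷ top)) (traversals x y (cell (row last) p ∷ bottom)) (rungTraversals x y 2 k)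
        where
        lemma : ∀ w u a b r → w + (u + a + b + r) ≡ u + (a + b + r + w)
        lemma = solve-∀

      data BoundaryRow (t : ℕ) : Set where
        at0 : t ≡ 0 → BoundaryRow t
        at1 : t ≡ 1 → BoundaryRow t
        middle : 2 ≤ t → t < 2 + k → BoundaryRow t
        atPenult : t ≡ penult → BoundaryRow t
        atLast : t ≡ last → BoundaryRow t

      boundaryRow : ∀ t → t ≤ last → BoundaryRow t
      boundaryRow zero _ = at0 refl
      boundaryRow (suc zero) _ = at1 refl
      boundaryRow (suc (suc t)) t≤ with suc (suc t) ≟ penult | suc (suc t) ≟ last
      ... | yes e | _ = atPenult e
      ... | no _ | yes e = atLast e
      ... | no ≢penult | no ≢last = middle (s≤s (s≤s z≤n)) (≤∧≢⇒< (≤-pred (≤∧≢⇒< t≤ ≢last)) ≢penult)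

      vertical-once : ∀ t → t < last → (0 + inRange 0 1 t) + (0 + (inRange penult 1 t)) + 0 + inRange 1 (suc k) t ≡ 1
      vertical-once t t< with boundaryRow t (<⇒≤ t<)
      ... | at0 refl rewrite inRange-below 1 (suc k) 0 (s≤s z≤n) = refl
      ... | at1 refl rewrite inRange-inside 1 (suc k) 1 ≤-refl (s≤s (s≤s z≤n)) = refl
      ... | middle 2≤t@(s≤s _) t< rewrite ≡ᵇ-≢ penult t (λ e → <⇒≢ t< (sym e)) | inRange-inside 1 (suc k) t (≤-trans (s≤s z≤n) 2≤t) t< = refl
      ... | atPenult refl rewrite ≡ᵇ-refl penult | inRange-above 1 (suc k) penult ≤-refl = refl
      ... | atLast refl = ⊥-elim (<-irrefl refl t<)

      rung-once : ∀ t → t ≤ last → (χ (0 ≡ᵇ t) + 0) + (χ (last ≡ᵇ t) + 0) + inRange 2 k t + (χ (1 ≡ᵇ t) + χ (penult ≡ᵇ t)) ≡ 1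
      rung-once t t≤ with boundaryRow t t≤
      ... | at0 refl rewrite inRange-below 2 k 0 (s≤s z≤n) = refl
      ... | at1 refl rewrite inRange-below 2 k 1 ≤-refl = refl
      ... | middle 2≤t@(s≤s (s≤s _)) t< rewrite ≡ᵇ-≢ last t (λ e → <⇒≢ (≤-trans t< (n≤1+n _)) (sym e))
          | ≡ᵇ-≢ penult t (λ e → <⇒≢ t< (sym e)) | inRange-inside 2 k t 2≤t t< = refl
      ... | atPenult refl rewrite ≡ᵇ-≢ last penult (λ e → <⇒≢ ≤-refl (sym e)) | inRange-above 2 k penult ≤-refl | ≡ᵇ-refl penult = refl
      ... | atLast refl rewrite ≡ᵇ-refl last | inRange-above 2 k last (n≤1+n _) | ≡ᵇ-≢ penult last (<⇒≢ ≤-refl) = refl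

      once : ∀ x y → Adj G⁺ x y → uses x y ps⁺ ≡ 1
      once = uses≡1-from-added ps⁺ added total on-old on-vertical on-rung
        where
        on-old : ∀ x y → T (S (column x)) → T (S (column y)) → added x y ≡ 0
        on-old x y x∈S y∈S rewrite traversals-old x y (cell (row 0) p ∷ top) x∈S y∈S (Touches-rung _ _ _ (cell-ℓ-outside (row 0) ∷ cell-ℓ-outside (row 1) ∷ []))
          | traversals-old x y (cell (row last) p ∷ bottom) x∈S y∈S (Touches-rung _ _ _ (cell-ℓ-outside (row last) ∷ cell-ℓ-outside (row penult) ∷ []))
          | rungTraversals-old x y 2 k x∈S y∈S | traversals-detour-old x y 1 (suc k) x∈S y∈S = refl
        on-vertical : ∀ (i j : Fin n) → toℕ j ≡ suc (toℕ i) → added (cell i ℓ) (cell j ℓ) ≡ 1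
        on-vertical i j j≡1+i rewrite sameEdge-rung-vertical p ℓ i j 0 p≢ℓ z≤n | sameEdge-rung-vertical p ℓ i j last p≢ℓ ≤-refl
          | sameEdge-swap (cell i ℓ) (cell j ℓ) (cell (row last) ℓ) (cell (row penult) ℓ)
          | rungTraversals-vertical i j 2 k rungs≤n | traversals-detour-vertical i j 1 (suc k) j≡1+i penult≤last =
          trans (cong (λ z → (0 + z) + (0 + (traversals (cell i ℓ) (cell j ℓ) (segment ℓ penult 1))) + 0 + inRange 1 (suc k) (toℕ i)) (traversals-segment ℓ i j 0 1 j≡1+i 1≤last))
            (trans (cong (λ z → (0 + inRange 0 1 (toℕ i)) + (0 + z) + 0 + inRange 1 (suc k) (toℕ i)) (traversals-segment ℓ i j penult 1 j≡1+i (≤-reflexive (+-comm penult 1))))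
              (vertical-once (toℕ i) (subst (_≤ last) j≡1+i (Finₚ.toℕ≤pred[n] j))))
        cellₚ∉bottom : ∀ i → cell i p ∉ bottom
        cellₚ∉bottom i (here e) = cellₚ≢cellₗ i (row last) e
        cellₚ∉bottom i (there (here e)) = cellₚ≢cellₗ i (row penult) e
        on-rung : ∀ i → added (cell i p) (cell i ℓ) ≡ 1
        on-rung i rewrite sameEdge-rung p ℓ i 0 p≢ℓ z≤n | sameEdge-rung p ℓ i last p≢ℓ ≤-refl
          | traversals-∉ (cell i p) (cell i ℓ) top (cellₚ∉segmentₗ i 0 1)
          | traversals-∉ (cell i p) (cell i ℓ) bottom (cellₚ∉bottom i)
          | rungTraversals-rung i 2 k rungs≤n | traversals-detour-rung i 1 (suc k) penult≤last = rung-once (toℕ i) (Finₚ.toℕ≤pred[n] i)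

      top-elsewhere : ∀ z → ¬ z ≡ cell (row 0) p → ¬ z ≡ cell (row 1) ℓ → endCount z withTop ≡ endCount z ps
      top-elsewhere z = endCount-attach-elsewhere z (cell (row 0) p) top ps

      bottom-elsewhere : ∀ z → ¬ z ≡ cell (row last) p → ¬ z ≡ cell (row penult) ℓ → endCount z withBottom ≡ endCount z withTop
      bottom-elsewhere z = endCount-attach-elsewhere z (cell (row last) p) bottom withTop

      was-end-p : ∀ t → t ≤ last → endCount (cell (row t) p) ps ≡ χ ((t ≡ᵇ 0) ∨ (t ≡ᵇ last))
      was-end-p t t≤ rewrite old-ends-p t t≤ | par-p = refl

      p≢ℓ-at : ∀ t t' → ¬ cell (row t) p ≡ cell (row t') ℓ
      p≢ℓ-at t t' = cellₚ≢cellₗ (row t) (row t')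

      ℓ≢p-at : ∀ t t' → ¬ cell (row t) ℓ ≡ cell (row t') p
      ℓ≢p-at t t' e = cellₚ≢cellₗ (row t') (row t) (sym e)

      Avoids-rungs : ∀ t u → t ≤ last → (t < 2 ⊎ 2 + k ≤ t) → Avoids (cell (row t) u) 2 k
      Avoids-rungs t u t≤ was-end = Avoids-row (row t) u 2 k rungs≤n (Data.Sum.map (subst (_< 2) (sym (toℕ-row t t≤))) (subst (2 + k ≤_) (sym (toℕ-row t t≤))) was-end)
        where import Data.Sum

      withRungs-ends-p : ∀ t → t ≤ last → endCount (cell (row t) p) withRungs ≡ inRange 2 k t
      withRungs-ends-p t t≤ with boundaryRow t t≤
      ... | at0 refl = trans (endCount-addRungs-elsewhere 2 k withBottom _ (Avoids-rungs 0 p t≤ (inj₁ (s≤s z≤n))))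
                  (trans (bottom-elsewhere _ (cell-row-≢ 0 last p p z≤n ≤-refl (λ ())) (p≢ℓ-at 0 penult))
                    (trans (+-cancelʳ-≡ 1 _ 0 (trans (cong (endCount (cell (row 0) p) withTop +_) (sym (was-end-p 0 z≤n)))
                       (endCount-attach-joined (cell (row 0) p) top ps (ℓ≢p-at 1 0) (subst (_≤ 1) (sym (was-end-p 0 z≤n)) ≤-refl))))
                      (sym (inRange-below 2 k 0 (s≤s z≤n)))))
      ... | at1 refl = trans (endCount-addRungs-elsewhere 2 k withBottom _ (Avoids-rungs 1 p t≤ (inj₁ ≤-refl)))
                  (trans (bottom-elsewhere _ (cell-row-≢ 1 last p p 1≤last ≤-refl (λ ())) (p≢ℓ-at 1 penult))
                    (trans (top-elsewhere _ (cell-row-≢ 1 0 p p 1≤last z≤n (λ ())) (p≢ℓ-at 1 1))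
                      (trans (was-end-p 1 1≤last) (sym (inRange-below 2 k 1 ≤-refl)))))
      ... | middle 2≤t@(s≤s (s≤s _)) t< = trans (trans (sym (+-identityʳ _)) (trans (cong (endCount (cell (row t) p) withRungs +_) (sym was-end))
                   (endCount-addRungs-p 2 k withBottom t 2≤t t< rungs≤n (subst (_≤ 1) (sym was-end) z≤n)))) (sym (inRange-inside 2 k t 2≤t t<))
        where
        was-end : endCount (cell (row t) p) withBottom ≡ 0
        was-end = trans (bottom-elsewhere _ (cell-row-≢ t last p p t≤ ≤-refl (λ e → <⇒≢ (≤-trans t< (n≤1+n _)) e)) (p≢ℓ-at t penult))
              (trans (top-elsewhere _ (cell-row-≢ t 0 p p t≤ z≤n (λ ())) (p≢ℓ-at t 1))
                (trans (was-end-p t t≤) (cong χ (cong (false ∨_) (≡ᵇ-≢ t last (λ e → <⇒≢ (≤-trans t< (n≤1+n _)) e))))))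
      ... | atPenult refl = trans (endCount-addRungs-elsewhere 2 k withBottom _ (Avoids-rungs penult p t≤ (inj₂ ≤-refl)))
                  (trans (bottom-elsewhere _ (cell-row-≢ penult last p p penult≤last ≤-refl (λ e → <⇒≢ ≤-refl e)) (p≢ℓ-at penult penult))
                    (trans (top-elsewhere _ (cell-row-≢ penult 0 p p penult≤last z≤n (λ ())) (p≢ℓ-at penult 1))
                      (trans (was-end-p penult penult≤last) (trans (cong χ (cong (false ∨_) (≡ᵇ-≢ penult last (λ e → <⇒≢ ≤-refl e))))
                        (sym (inRange-above 2 k penult ≤-refl))))))
      ... | atLast refl = trans (endCount-addRungs-elsewhere 2 k withBottom _ (Avoids-rungs last p t≤ (inj₂ (n≤1+n _))))
                  (trans (+-cancelʳ-≡ 1 _ 0 (trans (cong (endCount (cell (row last) p) withBottom +_) (sym was-end))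
                     (endCount-attach-joined (cell (row last) p) bottom withTop (ℓ≢p-at penult last) (subst (_≤ 1) (sym was-end) ≤-refl))))
                    (sym (inRange-above 2 k last (n≤1+n _))))
        where
        was-end : endCount (cell (row last) p) withTop ≡ 1
        was-end = trans (top-elsewhere _ (cell-row-≢ last 0 p p ≤-refl z≤n (λ ())) (p≢ℓ-at last 1))
              (trans (was-end-p last ≤-refl) (cong χ (cong (false ∨_) (≡ᵇ-refl last))))

      withRungs-ends-ℓ : ∀ t → t ≤ last → endCount (cell (row t) ℓ) withRungs ≡ χ (1 ≡ᵇ t) + χ (penult ≡ᵇ t) + inRange 2 k t
      withRungs-ends-ℓ t t≤ with boundaryRow t t≤
      ... | at0 refl = trans (endCount-addRungs-elsewhere 2 k withBottom _ (Avoids-rungs 0 ℓ t≤ (inj₁ (s≤s z≤n))))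
                  (trans (bottom-elsewhere _ (ℓ≢p-at 0 last) (cell-row-≢ 0 penult ℓ ℓ z≤n penult≤last (λ ())))
                    (trans (top-elsewhere _ (ℓ≢p-at 0 0) (cell-row-≢ 0 1 ℓ ℓ z≤n 1≤last (λ ())))
                      (trans (old-ends-ℓ 0) (sym (inRange-below 2 k 0 (s≤s z≤n))))))
      ... | at1 refl = trans (endCount-addRungs-elsewhere 2 k withBottom _ (Avoids-rungs 1 ℓ t≤ (inj₁ ≤-refl)))
                  (trans (bottom-elsewhere _ (ℓ≢p-at 1 last) (cell-row-≢ 1 penult ℓ ℓ 1≤last penult≤last (λ ())))
                    (trans (endCount-attach-newEnd (cell (row 0) p) top ps (ℓ≢p-at 1 0))
                      (trans (cong (_+ 1) (old-ends-ℓ 1)) (cong (1 +_) (sym (inRange-below 2 k 1 ≤-refl))))))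
      ... | middle 2≤t@(s≤s (s≤s _)) t< = trans (endCount-addRungs-ℓ 2 k withBottom t 2≤t t< rungs≤n)
                  (trans (cong (_+ 1) (trans (bottom-elsewhere _ (ℓ≢p-at t last) (cell-row-≢ t penult ℓ ℓ t≤ penult≤last (<⇒≢ t<)))
                    (trans (top-elsewhere _ (ℓ≢p-at t 0) (cell-row-≢ t 1 ℓ ℓ t≤ 1≤last (λ ()))) (old-ends-ℓ t))))
                    (sym (cong₂ _+_ (cong χ (≡ᵇ-≢ penult t (λ e → <⇒≢ t< (sym e)))) (inRange-inside 2 k t 2≤t t<))))
      ... | atPenult refl = trans (endCount-addRungs-elsewhere 2 k withBottom _ (Avoids-rungs penult ℓ t≤ (inj₂ ≤-refl)))
                  (trans (endCount-attach-newEnd (cell (row last) p) bottom withTop (ℓ≢p-at penult last))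
                    (trans (cong (_+ 1) (trans (top-elsewhere _ (ℓ≢p-at penult 0) (cell-row-≢ penult 1 ℓ ℓ penult≤last 1≤last (λ ()))) (old-ends-ℓ penult)))
                      (sym (cong₂ _+_ (cong χ (≡ᵇ-refl penult)) (inRange-above 2 k penult ≤-refl)))))
      ... | atLast refl = trans (endCount-addRungs-elsewhere 2 k withBottom _ (Avoids-rungs last ℓ t≤ (inj₂ (n≤1+n _))))
                  (trans (bottom-elsewhere _ (ℓ≢p-at last last) (cell-row-≢ last penult ℓ ℓ ≤-refl penult≤last (λ e → <⇒≢ ≤-refl (sym e))))
                    (trans (top-elsewhere _ (ℓ≢p-at last 0) (cell-row-≢ last 1 ℓ ℓ ≤-refl 1≤last (λ ()))) (trans (old-ends-ℓ last)
                      (sym (cong₂ _+_ (cong χ (≡ᵇ-≢ penult last (λ e → <⇒≢ ≤-refl e))) (inRange-above 2 k last (n≤1+n _)))))))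

      new-ends : ∀ t → t ≤ last → χ (1 ≡ᵇ t) + χ (penult ≡ᵇ t) + inRange 2 k t ≡ χ (not ((t ≡ᵇ 0) ∨ (t ≡ᵇ last)))
      new-ends t t≤ with boundaryRow t t≤
      ... | at0 refl rewrite inRange-below 2 k 0 (s≤s z≤n) = refl
      ... | at1 refl rewrite inRange-below 2 k 1 ≤-refl = refl
      ... | middle 2≤t@(s≤s (s≤s _)) t< rewrite ≡ᵇ-≢ penult t (λ e → <⇒≢ t< (sym e)) | inRange-inside 2 k t 2≤t t<
          | ≡ᵇ-≢ t last (λ e → <⇒≢ (≤-trans t< (n≤1+n _)) e) = refl
      ... | atPenult refl rewrite ≡ᵇ-refl penult | inRange-above 2 k penult ≤-refl | ≡ᵇ-≢ penult last (λ e → <⇒≢ ≤-refl e) = refl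
      ... | atLast refl rewrite ≡ᵇ-≢ penult last (λ e → <⇒≢ ≤-refl e) | inRange-above 2 k last (n≤1+n _) | ≡ᵇ-refl last = refl

      exact-row : ∀ t → t ≤ last → ∀ v → endCount (cell (row t) v) ps⁺ ≡ expectedEnds S⁺ par⁺ (row t) v
      exact-row t t≤ v with columnKind v
      ... | atP refl rewrite ends-detour-p 1 (suc k) t penult≤last t≤ | withRungs-ends-p t t≤ | expectedEnds⁺-p (row t) | par-p | isEndRow-row t t≤ =
        trans (+-assoc (χ (1 ≡ᵇ t)) _ _) (trans (sym (+-assoc (χ (1 ≡ᵇ t)) _ _)) (new-ends t t≤))
      exact-row t t≤ v | atℓ refl rewrite ends-detour-elsewhere 1 (suc k) t ℓ (≢-sym p≢ℓ) | expectedEnds⁺-ℓ (row t) | isEndRow-row t t≤ | withRungs-ends-ℓ t t≤ = new-ends t t≤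
      exact-row t t≤ v | elsewhere v≢p v≢ℓ rewrite ends-detour-elsewhere 1 (suc k) t v v≢p
        | endCount-addRungs-elsewhere 2 k withBottom (cell (row t) v) (Avoids-column (row t) v 2 k v≢p v≢ℓ)
        | bottom-elsewhere (cell (row t) v) (v≢p ∘ cell-injectiveᶜ (row t) (row last) v p) (v≢ℓ ∘ cell-injectiveᶜ (row t) (row penult) v ℓ)
        | top-elsewhere (cell (row t) v) (v≢p ∘ cell-injectiveᶜ (row t) (row 0) v p) (v≢ℓ ∘ cell-injectiveᶜ (row t) (row 1) v ℓ)
        | expectedEnds⁺-other (row t) v v≢p v≢ℓ = ends-exact (row t) v

      invariant : Invariant S⁺ par⁺ ps⁺
      invariant = record
        { decomposition = paths , once
        ; ends-exact    = λ i v → ∀-row (λ i → endCount (cell i v) ps⁺ ≡ expectedEnds S⁺ par⁺ i v) (λ t t≤ → exact-row t t≤ v) i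
        ; rooted        = rooted⁺
        }

    extend : Σ (List (List V)) (Invariant S⁺ par⁺)
    extend with par p in par-p
    ... | true  = InteriorEnds.ps⁺ par-p , InteriorEnds.invariant par-p
    ... | false = BoundaryEnds.ps⁺ par-p , BoundaryEnds.invariant par-p

  size : (Fin m → Bool) → ℕ
  size S = ∑ (allFin m) (χ ∘ S)

  size-insert : ∀ S ℓ → S ℓ ≡ false → size (λ v → S v ∨ eqB v ℓ) ≡ suc (size S)
  size-insert S ℓ ℓ∉S = trans (∑χ-insert S ℓ (allFin m) ℓ∉S) (trans (cong (size S +_) (∑-χ-eqBʳ m ℓ)) (+-comm (size S) 1))

  size≡m⇒full : ∀ S → size S ≡ m → ∀ v → S v ≡ true
  size≡m⇒full S size≡m v with S v in v∈S
  ... | true  = refl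
  ... | false = ⊥-elim (<⇒≢ (∑χ<length S (allFin m) v (Mem.∈-allFin v) v∈S) (trans size≡m (sym (length-allFin m))))

  size<m⇒missing : ∀ S → size S < m → Σ (Fin m) λ v → S v ≡ false
  size<m⇒missing S size<m with findFalse S (allFin m)
  ... | inj₁ missing = missing
  ... | inj₂ full    = ⊥-elim (<⇒≢ size<m (trans (∑χ≡length S (allFin m) full) (length-allFin m)))

  Complete : Set
  Complete = Σ (Fin m → Bool) λ S → Σ (Fin m → Bool) λ par → Σ (List (List V)) λ ps →
    Invariant S par ps × (∀ v → S v ≡ true)

  -- The vertex set S stays connected, so the new vertex ℓ is a leaf of T restricted to S ∪ {ℓ}.
  grow : Connected Tr → Acyclic Tr → ∀ fuel S par ps → Invariant S par ps → S r ≡ true → size S + fuel ≡ m → Complete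
  grow _ _ zero S par ps inv _ size≡m = S , par , ps , inv , size≡m⇒full S (trans (sym (+-identityʳ _)) size≡m)
  grow connected acyclic (suc fuel) S par ps inv r∈S size+ with size<m⇒missing S (subst (size S <_) size+ (m<m+n (size S) (s≤s z≤n)))
  ... | v , v∉S with boundary-edge (≡true⇒T r∈S) v∉S (connected r v)
  ...   | p , ℓ , p∈S , ℓ∉S , p~ℓ =
    grow connected acyclic fuel S⁺ par⁺ (proj₁ extend) (proj₂ extend) (cong (_∨ eqB r ℓ) r∈S)
      (trans (cong (_+ fuel) (size-insert S ℓ ℓ∉S)) (trans (sym (+-suc (size S) fuel)) size+))
    where
    open Invariant inv
    ℓ-leaf : ∀ q → S q ≡ true → Adj Tr ℓ q → q ≡ p
    ℓ-leaf q q∈S ℓ~q = acyclic⇒unique-neighbour acyclic ℓ∉S (subst T (symm Tr p ℓ) p~ℓ) ℓ~q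
      (reverse (rooted p p∈S) ++ʷ rooted q (≡true⇒T q∈S))
    open LeafStep S par ps p ℓ (T⇒≡true p∈S) ℓ∉S p~ℓ ℓ-leaf inv using (S⁺; par⁺; extend)

  S₀ : Fin m → Bool
  S₀ v = eqB v r

  par₀ : Fin m → Bool
  par₀ _ = false

  ps₀ : List (List V)
  ps₀ = segment r 0 last ∷ []

  initial-vertical-once : ∀ (i j : Fin n) → toℕ j ≡ suc (toℕ i) → ∑ ps₀ (traversals (cell i r) (cell j r)) ≡ 1
  initial-vertical-once i j j≡1+i = trans (+-identityʳ _) (trans (traversals-segment r i j 0 last j≡1+i ≤-refl)
    (inRange-inside 0 last (toℕ i) z≤n (subst (_≤ last) j≡1+i (Finₚ.toℕ≤pred[n] j))))

  initial-once-cells : ∀ i u j w → Adj G[ S₀ ] (cell i u) (cell j w) → ∑ ps₀ (traversals (cell i u) (cell j w)) ≡ 1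
  initial-once-cells i u j w e with ∧≡true (prodAdj Pₙ Tr (i , u) (j , w)) (S₀ u ∧ S₀ w) (T⇒≡true (subst T (adj-G[]-cell S₀ i u j w) e))
  ... | adjacent , in-S₀ with ∧≡true (S₀ u) (S₀ w) in-S₀
  ... | u≡r , w≡r with eqB⇒≡ {a = u} u≡r | eqB⇒≡ {a = w} w≡r
  ... | refl | refl with prodAdj⇒ Pₙ Tr i r j r adjacent
  ... | inj₂ (_ , r~r) = ⊥-elim (subst T (irrefl Tr r) (≡true⇒T r~r))
  ... | inj₁ (i~j , _) with PathGraph-adj⇒ i j i~j
  ... | inj₁ j≡1+i = initial-vertical-once i j j≡1+i
  ... | inj₂ i≡1+j = trans (∑-cong ps₀ (traversals-sym (cell i r) (cell j r))) (initial-vertical-once j i i≡1+j)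

  initial-once : ∀ x y → Adj G[ S₀ ] x y → uses x y ps₀ ≡ 1
  initial-once x y e = trans (uses≡∑traversals x y ps₀)
    (∀-cell (λ x → ∀ y → Adj G[ S₀ ] x y → ∑ ps₀ (traversals x y) ≡ 1) (λ i u →
     ∀-cell (λ y → Adj G[ S₀ ] (cell i u) y → ∑ ps₀ (traversals (cell i u) y) ≡ 1) (initial-once-cells i u)) x y e)

  initial-ends-row : ∀ t → t ≤ last → ∀ v → endCount (cell (row t) v) ps₀ ≡ expectedEnds S₀ par₀ (row t) v
  initial-ends-row t t≤ v rewrite segment-last r 0 last | eqB-cell-rows 0 t r v z≤n t≤ | eqB-cell-rows last t r v ≤-refl t≤
    | eqB-sym r v | isEndRow-row t t≤ with eqB v r
  ... | false rewrite Bool.∧-zeroʳ (0 ≡ᵇ t) | Bool.∧-zeroʳ (last ≡ᵇ t) = refl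
  ... | true rewrite Bool.∧-identityʳ (0 ≡ᵇ t) | Bool.∧-identityʳ (last ≡ᵇ t) with rowPosition t t≤
  ...   | first refl = refl
  ...   | final refl rewrite ≡ᵇ-refl last = refl
  ...   | interior (s≤s _) t<last rewrite ≡ᵇ-≢ last t (≢-sym (<⇒≢ t<last)) | ≡ᵇ-≢ t last (<⇒≢ t<last) = refl

  initial : Invariant S₀ par₀ ps₀
  initial = record
    { decomposition = ((s≤s (s≤s z≤n) , segment-unique r 0 last ≤-refl , segment-linked S₀ r 0 last (eqB-refl r) ≤-refl) ∷ [])
                    , initial-once
    ; ends-exact    = λ i v → ∀-row (λ i → endCount (cell i v) ps₀ ≡ expectedEnds S₀ par₀ i v) (λ t t≤ → initial-ends-row t t≤ v) i
    ; rooted        = λ v v∈S₀ → subst (Walk S₀ r) (sym (eqB⇒≡ (T⇒≡true v∈S₀))) (nil (≡true⇒T (eqB-refl r)))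
    }

  adj-G[]⇒adj : ∀ S x y → Adj G[ S ] x y → Adj G x y
  adj-G[]⇒adj S x y e with adj G x y
  ... | true = _

  adj⇒adj-G[] : ∀ S → (∀ v → S v ≡ true) → ∀ x y → Adj G x y → Adj G[ S ] x y
  adj⇒adj-G[] S full x y e rewrite full (column x) | full (column y) | T⇒≡true e = _

  pathNumber-P□T : Connected Tr → Acyclic Tr → PathNumber G (n-odd G / 2)
  pathNumber-P□T connected acyclic with grow connected acyclic (m ∸ 1) S₀ par₀ ps₀ initial (eqB-refl r) size₀
    where
    size₀ : size S₀ + (m ∸ 1) ≡ m
    size₀ = trans (cong (_+ (m ∸ 1)) (∑-χ-eqBʳ m r)) (m+[n∸m]≡n (≤-trans (s≤s z≤n) (Finₚ.toℕ<n r)))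
  ... | S , par , ps , inv , full = pathNumber-from-decomposition G ps (paths , once) ends≤1
    where
    open Invariant inv
    paths : All (IsPath G) ps
    paths = All.map (λ (len , u , lk) → len , u , Linked.map (adj-G[]⇒adj S _ _) lk) (proj₁ decomposition)
    once : ∀ x y → Adj G x y → uses x y ps ≡ 1
    once x y e = proj₂ decomposition x y (adj⇒adj-G[] S full x y e)
    ends≤1 : ∀ x → endCount x ps ≤ 1
    ends≤1 = ∀-cell (λ x → endCount x ps ≤ 1) (λ i u → subst (_≤ 1) (sym (ends-exact i u)) (χ≤1 _))

theorem5p2 : ∀ {m} (T : Graph m) → IsTree T → (n : ℕ) → 4 ≤ n →
    PathNumber (PathGraph n □ T) (n-odd (PathGraph n □ T) / 2)
theorem5p2 {zero} T (() , _ , _) n le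
theorem5p2 {suc m} T (_ , connected , acyclic) (suc (suc (suc (suc k)))) (s≤s (s≤s (s≤s (s≤s _)))) =
  Construction.pathNumber-P□T T k Fin.zero connected acyclic
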